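{- Let $R$ be a linear term rewriting system over a signature $\Sigma$. If $R^\circ$ is terminating on $\mathbf{FinGraph}(\Sigma^\circ)$ (no infinite sequence of PBPO$^+$ rewrite steps via rules of $R^\circ$ on finite $\Sigma^\circ$-labeled graphs), then $R$ is terminating.
   Context: Terms over signature $\Sigma$ (arities $\#$) and variables $\mathcal{X}$; linear = each variable at most once. Rules $l\to r$ with $l\notin\mathcal{X}$, $\mathrm{Var}(r)\subseteq\mathrm{Var}(l)$; linear if $l,r$ linear; rewrite relation $C[l\sigma]\to C[r\sigma]$; $R$ terminating if no infinite rewrite sequence. $\mathbf{FinGraph}(\Sigma^\circ)$: finite graphs with vertex/edge labels in the flat lattice $\Sigma^\circ=(\Sigma\uplus\mathbb{N}^+)\uplus\{\bot,\top\}$ ($\bot$ least, $\top$ greatest, others incomparable); morphisms commute with source/target and satisfy $\ell(x)\le\ell(\phi(x))$. PBPO$^+$: a rule is $L,K,R,L',K'$ with $l:K\to L$, $r:K\to R$, $l':K'\to L'$, monos $t_L:L\rightarrowtail L'$, $t_K:K\rightarrowtail K'$, $t_L\circ l=l'\circ t_K$ a pullback. A step $G_L\Rightarrow G_R$: a mono $m:L\rightarrowtail G_L$ and $\alpha:G_L\to L'$ with $\alpha\circ m=t_L$ and ($L$, $1_L$, $m$) a pullback of $t_L,\alpha$; $(G_K,g_L,u')$ a pullback of $\alpha,l'$; $u:K\to G_K$ the unique morphism with $u'\circ u=t_K$, $g_L\circ u=m\circ l$; $G_R$ a pushout of $u$ and $r$. Encodings: for linear $t$, $t^\circ$ has a vertex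 $p$ labeled $f$ per position $p$ holding symbol $f$, a vertex $x$ labeled $\bot$ per variable $x$, and an edge labeled $i$ from the vertex at $p$ to that at $pi$; root at $\epsilon$. The context closure $\mathcal{C}[G{\downarrow_\mathcal{X}}]$ of a rooted graph: relabel each variable vertex $x$ to $\top$, add fresh $\top$-vertex $x'$ with $\top$-edges $x\to x'$, $x'\to x'$; add fresh $\top$-vertex $\mathcal{C}$ with $\top$-edges $\mathcal{C}\to$ root and $\mathcal{C}\to\mathcal{C}$. $\mathcal{I}(r)$: discrete graph on $\mathrm{Var}(r)\cup\{\epsilon\}$ labeled $\bot$. $\rho^\circ$: $L=l^\circ$, $K=\mathcal{I}(r)$, $R=r^\circ$, $L'=\mathcal{C}[l^\circ{\downarrow_\mathcal{X}}]$, $K'=\mathcal{C}[\mathcal{I}(r){\downarrow_\mathcal{X}}]$, morphisms mapping roots to roots and inclusions otherwise; $R^\circ=\{\rho^\circ\mid\rho\in R\}$. -}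

module Defs where

open import Level using (Level) renaming (suc to lsuc; zero to lzero)
open import Data.Nat using (ℕ; zero; suc; _+_)
import Data.Nat.Properties as ℕP
open import Data.Fin using (Fin; zero; suc)
import Data.Fin.Properties as FinP
open import Data.Vec using (Vec; []; _∷_; lookup; _[_]≔_)
open import Data.List using (List; []; _∷_; _++_; length; map)
import Data.List as List
open import Data.List.Membership.Propositional using (_∈_)
open import Data.List.Relation.Unary.Unique.Propositional using (Unique)
open import Data.Maybe using (Maybe; just; nothing)
import Data.Maybe
open import Data.Product using (Σ; Σ-syntax; ∃; _×_; _,_; proj₁; proj₂)
import Data.Product as Prod
open import Data.Sum using (_⊎_; inj₁; inj₂; [_,_])
open import Data.Sum.Function.Propositional using (_⊎-↔_)
open import Data.Unit using (⊤; tt)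
open import Data.Empty using (⊥; ⊥-elim)
open import Relation.Nullary using (¬_; Dec; yes; no)
open import Relation.Binary.PropositionalEquality using (_≡_; refl; sym; trans; cong; subst)
open import Function.Bundles using (_↔_; Inverse)
open import Function.Properties.Inverse using (↔-sym; ↔-trans; ↔-refl)

record Signature : Set₁ where
  field
    Sym : Set
    ar  : Sym → ℕ

module Labels (Sym : Set) where

  -- 'pos n' denotes the positive natural number n + 1  (so ℕ⁺ ≅ ℕ).
  data Lab : Set where
    fsym : Sym → Lab
    pos : ℕ → Lab
    bot : Lab
    top : Lab

  data _≤L_ : Lab → Lab → Set where
    bot≤  : ∀ {x} → bot ≤L x
    ≤top  : ∀ {x} → x ≤L top
    ≤refl : ∀ {x} → x ≤L x

Finite : Set → Set
Finite A = Σ ℕ λ n → A ↔ Fin n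

module Graphs (Sym : Set) where

  open Labels Sym public

  record Graph : Set₁ where
    field
      V    : Set
      E    : Set
      finV : Finite V
      finE : Finite E
      src  : E → V
      tgt  : E → V
      lV   : V → Lab
      lE   : E → Lab
  open Graph public

  record Hom (G H : Graph) : Set where
    field
      fV    : V G → V H
      fE    : E G → E H
      srcC  : ∀ e → fV (src G e) ≡ src H (fE e)
      tgtC  : ∀ e → fV (tgt G e) ≡ tgt H (fE e)
      lV≤   : ∀ v → lV G v ≤L lV H (fV v)
      lE≤   : ∀ e → lE G e ≤L lE H (fE e)
  open Hom public

  idH : ∀ {G} → Hom G G
  idH = record { fV = λ v → v ; fE = λ e → e ; srcC = λ _ → refl ; tgtC = λ _ → refl
               ; lV≤ = λ _ → ≤refl ; lE≤ = λ _ → ≤refl }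

  ≤L-trans : ∀ {x y z} → x ≤L y → y ≤L z → x ≤L z
  ≤L-trans bot≤  q     = bot≤
  ≤L-trans ≤refl q     = q
  ≤L-trans ≤top  ≤top  = ≤top
  ≤L-trans ≤top  ≤refl = ≤top

  infixr 9 _∘H_
  _∘H_ : ∀ {F G H} → Hom G H → Hom F G → Hom F H
  _∘H_ {F} {G} {H} g f = record
    { fV   = λ v → fV g (fV f v)
    ; fE   = λ e → fE g (fE f e)
    ; srcC = λ e → trans (cong (fV g) (srcC f e)) (srcC g (fE f e))
    ; tgtC = λ e → trans (cong (fV g) (tgtC f e)) (tgtC g (fE f e))
    ; lV≤  = λ v → ≤L-trans (lV≤ f v) (lV≤ g (fV f v))
    ; lE≤  = λ e → ≤L-trans (lE≤ f e) (lE≤ g (fE f e))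
    }

  infix 4 _≈H_
  _≈H_ : ∀ {G H} → Hom G H → Hom G H → Set
  f ≈H g = (∀ v → fV f v ≡ fV g v) × (∀ e → fE f e ≡ fE g e)

  Mono : ∀ {A B} → Hom A B → Set₁
  Mono {A} m = ∀ {X} (a b : Hom X A) → m ∘H a ≈H m ∘H b → a ≈H b

  IsPullback : ∀ {A B C P} (f : Hom A C) (g : Hom B C) (p : Hom P A) (q : Hom P B) → Set₁
  IsPullback {A} {B} {C} {P} f g p q =
    (f ∘H p ≈H g ∘H q) ×
    (∀ (Q : Graph) (p₁ : Hom Q A) (q₁ : Hom Q B) → f ∘H p₁ ≈H g ∘H q₁ →
       Σ (Hom Q P) λ h → (p ∘H h ≈H p₁) × (q ∘H h ≈H q₁) ×
         (∀ (h' : Hom Q P) → p ∘H h' ≈H p₁ → q ∘H h' ≈H q₁ → h' ≈H h))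

  IsPushout : ∀ {A B C P} (f : Hom C A) (g : Hom C B) (p : Hom A P) (q : Hom B P) → Set₁
  IsPushout {A} {B} {C} {P} f g p q =
    (p ∘H f ≈H q ∘H g) ×
    (∀ (Q : Graph) (p₁ : Hom A Q) (q₁ : Hom B Q) → p₁ ∘H f ≈H q₁ ∘H g →
       Σ (Hom P Q) λ h → (h ∘H p ≈H p₁) × (h ∘H q ≈H q₁) ×
         (∀ (h' : Hom P Q) → h' ∘H p ≈H p₁ → h' ∘H q ≈H q₁ → h' ≈H h))

  -- Well-formedness conditions of a rule
  -- (monos, pullback square) are not needed to define a step.
  record PBPORule : Set₁ where
    field
      L K R L' K' : Graph
      l  : Hom K L
      r  : Hom K R
      l' : Hom K' L'
      tL : Hom L L'
      tK : Hom K K'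

  PBPOStep : PBPORule → Graph → Graph → Set₁
  PBPOStep ρ GL GR =
    Σ (Hom L GL) λ m → Mono m ×
    Σ (Hom GL L') λ α → (α ∘H m ≈H tL) × IsPullback tL α (idH {L}) m ×
    Σ Graph λ GK → Σ (Hom GK GL) λ gL → Σ (Hom GK K') λ u' →
      IsPullback α l' gL u' ×
    Σ (Hom K GK) λ u → (u' ∘H u ≈H tK) × (gL ∘H u ≈H m ∘H l) ×
    Σ (Hom GK GR) λ w → Σ (Hom R GR) λ v → IsPushout u r w v
    where open PBPORule ρ

module TRSDefs (S : Signature) where

  open Signature S

  data Term : Set where
    var : ℕ → Term
    app : (f : Sym) → Vec Term (ar f) → Term

  mutual
    vars : Term → List ℕ
    vars (var x)    = x ∷ []
    vars (app f ts) = varsV ts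

    varsV : ∀ {n} → Vec Term n → List ℕ
    varsV []       = []
    varsV (t ∷ ts) = vars t ++ varsV ts

  LinearTerm : Term → Set
  LinearTerm t = Unique (vars t)

  mutual
    _[_]ₛ : Term → (ℕ → Term) → Term
    var x    [ σ ]ₛ = σ x
    app f ts [ σ ]ₛ = app f (ts [ σ ]ₛᵥ)

    _[_]ₛᵥ : ∀ {n} → Vec Term n → (ℕ → Term) → Vec Term n
    []       [ σ ]ₛᵥ = []
    (t ∷ ts) [ σ ]ₛᵥ = (t [ σ ]ₛ) ∷ (ts [ σ ]ₛᵥ)

  record Rule : Set where
    field
      lhs     : Term
      rhs     : Term
      lhsNVar : ∀ x → ¬ (lhs ≡ var x)
      varsSub : ∀ x → x ∈ vars rhs → x ∈ vars lhs
  open Rule public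

  TRS : Set₁
  TRS = Rule → Set

  LinearRule : Rule → Set
  LinearRule ρ = LinearTerm (lhs ρ) × LinearTerm (rhs ρ)

  LinearTRS : TRS → Set
  LinearTRS R = ∀ ρ → R ρ → LinearRule ρ

  data Step (R : TRS) : Term → Term → Set where
    root : ∀ ρ → R ρ → (σ : ℕ → Term) → Step R (lhs ρ [ σ ]ₛ) (rhs ρ [ σ ]ₛ)
    ctx  : ∀ f (ts : Vec Term (ar f)) (i : Fin (ar f)) {t'} →
           Step R (lookup ts i) t' → Step R (app f ts) (app f (ts [ i ]≔ t'))

  Terminating : TRS → Set
  Terminating R = ¬ (Σ (ℕ → Term) λ s → ∀ n → Step R (s n) (s (suc n)))

fin⊤ : Finite ⊤
fin⊤ = 1 , ↔-sym FinP.1↔⊤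

fin⊥ : Finite ⊥
fin⊥ = 0 , ↔-sym FinP.0↔⊥

finFin : ∀ k → Finite (Fin k)
finFin k = k , ↔-refl

fin⊎ : ∀ {A B} → Finite A → Finite B → Finite (A ⊎ B)
fin⊎ (m , a) (n , b) = m + n , ↔-trans (a ⊎-↔ b) (↔-sym FinP.+↔⊎)

finDec : ∀ {A} → Finite A → (x y : A) → Dec (x ≡ y)
finDec (n , i) x y with Inverse.to i x FinP.≟ Inverse.to i y
... | yes p = yes (trans (sym (Inverse.strictlyInverseʳ i x))
                  (trans (cong (Inverse.from i) p) (Inverse.strictlyInverseʳ i y)))
... | no ¬p = no (λ e → ¬p (cong (Inverse.to i) e))

module Encoding (S : Signature) where

  open Signature S
  open TRSDefs S public
  open Graphs Sym public

  -- rooted term graph, together with the list of its variable vertices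
  record TG : Set₁ where
    field
      g    : Graph
      rt   : V g
      vl   : List (ℕ × V g)
  open TG public

  single : Lab → Graph
  single a = record
    { V = ⊤ ; E = ⊥ ; finV = fin⊤ ; finE = fin⊥
    ; src = λ () ; tgt = λ () ; lV = λ _ → a ; lE = λ () }

  attach : TG → Lab → TG → TG
  attach T i C = record
    { g = record
        { V = V (g T) ⊎ V (g C)
        ; E = E (g T) ⊎ (E (g C) ⊎ ⊤)
        ; finV = fin⊎ (finV (g T)) (finV (g C))
        ; finE = fin⊎ (finE (g T)) (fin⊎ (finE (g C)) fin⊤)
        ; src = [ (λ e → inj₁ (src (g T) e)) , [ (λ e → inj₂ (src (g C) e)) , (λ _ → inj₁ (rt T)) ] ]
        ; tgt = [ (λ e → inj₁ (tgt (g T) e)) , [ (λ e → inj₂ (tgt (g C) e)) , (λ _ → inj₂ (rt C)) ] ]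
        ; lV = [ lV (g T) , lV (g C) ]
        ; lE = [ lE (g T) , [ lE (g C) , (λ _ → i) ] ]
        }
    ; rt = inj₁ (rt T)
    ; vl = map (Prod.map₂ inj₁) (vl T) ++ map (Prod.map₂ inj₂) (vl C)
    }

  -- t° : vertices are the positions of t (a variable position is the
  -- vertex of that variable, labelled ⊥); edge p → p i labelled i
  -- (the i-th argument, i : Fin (ar f), gets label  pos (toℕ i),  i.e. i+1)
  mutual
    termG : Term → TG
    termG (var x)    = record { g = single bot ; rt = tt ; vl = (x , tt) ∷ [] }
    termG (app f ts) = attachAll (record { g = single (fsym f) ; rt = tt ; vl = [] }) 0 ts

    attachAll : TG → ℕ → ∀ {n} → Vec Term n → TG
    attachAll T i []       = T
    attachAll T i (t ∷ ts) = attachAll (attach T (pos i) (termG t)) (suc i) ts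

  markTop : ∀ {P : Set} → Dec P → Lab → Lab
  markTop (yes _) a = top
  markTop (no _)  a = a

  isVarV : (G : Graph) → ∀ {k} → (vv : Fin k → V G) → (v : V G) → Dec (∃ λ j → vv j ≡ v)
  isVarV G vv v = FinP.any? (λ j → finDec (finV G) (vv j) v)

  -- context closure  𝒞[G↓𝒳]  of a rooted graph G whose variable vertices
  -- are  vv 0, …, vv (k-1):
  --   vertices  V G ⊎ (Fin k ⊎ ⊤)       (inj₂ (inj₁ j) = x'_j,  inj₂ (inj₂ tt) = 𝒞)
  --   edges     E G ⊎ ((Fin k ⊎ Fin k) ⊎ (⊤ ⊎ ⊤))
  --             x_j → x'_j,  x'_j → x'_j,  𝒞 → root,  𝒞 → 𝒞   (all labelled ⊤)
  closure : (G : Graph) → V G → (k : ℕ) → (Fin k → V G) → Graph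
  closure G ρ k vv = record
    { V = V G ⊎ (Fin k ⊎ ⊤)
    ; E = E G ⊎ ((Fin k ⊎ Fin k) ⊎ (⊤ ⊎ ⊤))
    ; finV = fin⊎ (finV G) (fin⊎ (finFin k) fin⊤)
    ; finE = fin⊎ (finE G) (fin⊎ (fin⊎ (finFin k) (finFin k)) (fin⊎ fin⊤ fin⊤))
    ; src = [ (λ e → inj₁ (src G e))
            , [ [ (λ j → inj₁ (vv j)) , (λ j → inj₂ (inj₁ j)) ]
              , [ (λ _ → inj₂ (inj₂ tt)) , (λ _ → inj₂ (inj₂ tt)) ] ] ]
    ; tgt = [ (λ e → inj₁ (tgt G e))
            , [ [ (λ j → inj₂ (inj₁ j)) , (λ j → inj₂ (inj₁ j)) ]
              , [ (λ _ → inj₁ ρ) , (λ _ → inj₂ (inj₂ tt)) ] ] ]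
    ; lV = [ (λ v → markTop (isVarV G vv v) (lV G v)) , (λ _ → top) ]
    ; lE = [ lE G , (λ _ → top) ]
    }

  -- 𝓘(r) for a term graph with k variables: discrete graph on {ε} ⊎ Var(r),
  -- all labelled ⊥
  Igraph : ℕ → Graph
  Igraph k = record
    { V = ⊤ ⊎ Fin k ; E = ⊥ ; finV = fin⊎ fin⊤ (finFin k) ; finE = fin⊥
    ; src = λ () ; tgt = λ () ; lV = λ _ → bot ; lE = λ () }

  find : ∀ {A : Set} (xs : List (ℕ × A)) → ℕ → Maybe (Fin (length xs))
  find []             x = nothing
  find ((y , a) ∷ xs) x with y ℕP.≟ x
  ... | yes _ = just zero
  ... | no _  = Data.Maybe.map suc (find xs x)

  markTop-≤ : ∀ {P : Set} (d : Dec P) a → a ≤L markTop d a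
  markTop-≤ (yes _) a = ≤top
  markTop-≤ (no _)  a = ≤refl

  markTop-yes : ∀ {P : Set} (d : Dec P) a → P → markTop d a ≡ top
  markTop-yes (yes _) a p = refl
  markTop-yes (no ¬p) a p = ⊥-elim (¬p p)

  ≤top≡ : ∀ {x y} → y ≡ top → x ≤L y
  ≤top≡ refl = ≤top

  module Enc (ρ : Rule) where
    Lt Rt : TG
    Lt = termG (lhs ρ)
    Rt = termG (rhs ρ)

    GL GR : Graph
    GL = g Lt
    GR = g Rt

    kL kR : ℕ
    kL = length (vl Lt)
    kR = length (vl Rt)

    vvL : Fin kL → V GL
    vvL j = proj₂ (List.lookup (vl Lt) j)

    vvR : Fin kR → V GR
    vvR j = proj₂ (List.lookup (vl Rt) j)

    loc : Fin kR → Maybe (Fin kL)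
    loc j = find (vl Lt) (proj₁ (List.lookup (vl Rt) j))

    Kg L'g K'g : Graph
    Kg  = Igraph kR
    L'g = closure GL (rt Lt) kL vvL
    K'g = closure Kg (inj₁ tt) kR inj₂

    Cv : V L'g
    Cv = inj₂ (inj₂ tt)

    CCe : E L'g
    CCe = inj₂ (inj₂ (inj₂ tt))

    xV x'V : Maybe (Fin kL) → V L'g
    xV (just φ) = inj₁ (vvL φ)
    xV nothing  = Cv
    x'V (just φ) = inj₂ (inj₁ φ)
    x'V nothing  = Cv

    xeE loopE : Maybe (Fin kL) → E L'g
    xeE (just φ) = inj₂ (inj₁ (inj₁ φ))
    xeE nothing  = CCe
    loopE (just φ) = inj₂ (inj₁ (inj₂ φ))
    loopE nothing  = CCe

    lHom : Hom Kg GL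
    lHom = record
      { fV = [ (λ _ → rt Lt) , (λ j → Data.Maybe.maybe vvL (rt Lt) (loc j)) ]
      ; fE = λ () ; srcC = λ () ; tgtC = λ () ; lV≤ = λ _ → bot≤ ; lE≤ = λ () }

    rHom : Hom Kg GR
    rHom = record
      { fV = [ (λ _ → rt Rt) , vvR ]
      ; fE = λ () ; srcC = λ () ; tgtC = λ () ; lV≤ = λ _ → bot≤ ; lE≤ = λ () }

    tLHom : Hom GL L'g
    tLHom = record
      { fV = inj₁ ; fE = inj₁ ; srcC = λ _ → refl ; tgtC = λ _ → refl
      ; lV≤ = λ v → markTop-≤ (isVarV GL vvL v) (lV GL v) ; lE≤ = λ _ → ≤refl }

    tKHom : Hom Kg K'g
    tKHom = record
      { fV = inj₁ ; fE = inj₁ ; srcC = λ _ → refl ; tgtC = λ _ → refl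
      ; lV≤ = λ v → markTop-≤ (isVarV Kg inj₂ v) (lV Kg v) ; lE≤ = λ _ → ≤refl }

    l'V : V K'g → V L'g
    l'V (inj₁ (inj₁ tt)) = inj₁ (rt Lt)
    l'V (inj₁ (inj₂ j))  = xV (loc j)
    l'V (inj₂ (inj₁ j))  = x'V (loc j)
    l'V (inj₂ (inj₂ tt)) = Cv

    l'E : E K'g → E L'g
    l'E (inj₁ ())
    l'E (inj₂ (inj₁ (inj₁ j))) = xeE (loc j)
    l'E (inj₂ (inj₁ (inj₂ j))) = loopE (loc j)
    l'E (inj₂ (inj₂ (inj₁ tt))) = inj₂ (inj₂ (inj₁ tt))
    l'E (inj₂ (inj₂ (inj₂ tt))) = CCe

    l'srcC : ∀ e → l'V (src K'g e) ≡ src L'g (l'E e)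
    l'srcC (inj₁ ())
    l'srcC (inj₂ (inj₁ (inj₁ j))) with loc j
    ... | just φ = refl
    ... | nothing = refl
    l'srcC (inj₂ (inj₁ (inj₂ j))) with loc j
    ... | just φ = refl
    ... | nothing = refl
    l'srcC (inj₂ (inj₂ (inj₁ tt))) = refl
    l'srcC (inj₂ (inj₂ (inj₂ tt))) = refl

    l'tgtC : ∀ e → l'V (tgt K'g e) ≡ tgt L'g (l'E e)
    l'tgtC (inj₁ ())
    l'tgtC (inj₂ (inj₁ (inj₁ j))) with loc j
    ... | just φ = refl
    ... | nothing = refl
    l'tgtC (inj₂ (inj₁ (inj₂ j))) with loc j
    ... | just φ = refl
    ... | nothing = refl
    l'tgtC (inj₂ (inj₂ (inj₁ tt))) = refl
    l'tgtC (inj₂ (inj₂ (inj₂ tt))) = refl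

    xVtop : ∀ m → lV L'g (xV m) ≡ top
    xVtop (just φ) = markTop-yes (isVarV GL vvL (vvL φ)) _ (φ , refl)
    xVtop nothing  = refl

    x'Vtop : ∀ m → lV L'g (x'V m) ≡ top
    x'Vtop (just φ) = refl
    x'Vtop nothing  = refl

    l'lV≤ : ∀ v → lV K'g v ≤L lV L'g (l'V v)
    l'lV≤ (inj₁ (inj₁ tt)) with isVarV Kg inj₂ (inj₁ tt)
    ... | yes (_ , ())
    ... | no _ = bot≤
    l'lV≤ (inj₁ (inj₂ j))  = ≤top≡ (xVtop (loc j))
    l'lV≤ (inj₂ (inj₁ j))  = ≤top≡ (x'Vtop (loc j))
    l'lV≤ (inj₂ (inj₂ tt)) = ≤top

    l'lE≤ : ∀ e → lE K'g e ≤L lE L'g (l'E e)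
    l'lE≤ (inj₁ ())
    l'lE≤ (inj₂ (inj₁ (inj₁ j))) with loc j
    ... | just φ = ≤top
    ... | nothing = ≤top
    l'lE≤ (inj₂ (inj₁ (inj₂ j))) with loc j
    ... | just φ = ≤top
    ... | nothing = ≤top
    l'lE≤ (inj₂ (inj₂ (inj₁ tt))) = ≤top
    l'lE≤ (inj₂ (inj₂ (inj₂ tt))) = ≤top

    l'Hom : Hom K'g L'g
    l'Hom = record { fV = l'V ; fE = l'E ; srcC = l'srcC ; tgtC = l'tgtC
                   ; lV≤ = l'lV≤ ; lE≤ = l'lE≤ }

    rule° : PBPORule
    rule° = record
      { L = GL ; K = Kg ; R = GR ; L' = L'g ; K' = K'g
      ; l = lHom ; r = rHom ; l' = l'Hom ; tL = tLHom ; tK = tKHom }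

  _° : Rule → PBPORule
  ρ ° = Enc.rule° ρ

  Step° : TRS → Graph → Graph → Set₁
  Step° R G H = Σ Rule λ ρ → R ρ × PBPOStep (ρ °) G H

  Terminating° : TRS → Set₁
  Terminating° R = ¬ (Σ (ℕ → Graph) λ Gs → ∀ n → Step° R (Gs n) (Gs (suc n)))

module Submission where

-- Represent each term t by a tree-shaped graph and simulate every rewrite step t → t' of R by a
-- PBPO⁺ step of R° between the representations; an infinite R-reduction then gives an infinite
-- R°-reduction.  For a root step lσ → rσ the match is l° inside the graph of lσ, and α keeps the
-- pattern part while sending the root of each substituted σ x to the vertex x and the rest of
-- σ x to the looping vertex x′.  Pulling back along l' yields one copy of σ x for each variable
-- of r (both sides are linear), and the pushout glues these copies under r°.  A step inside an
-- argument is lifted one edge at a time: the surrounding context is sent to the vertex 𝒞 with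
-- its loop, and the edge into the rewritten argument follows the image of its root.

open import Defs
open import Axiom.UniquenessOfIdentityProofs.WithK using (uip)
open import Data.Bool using (Bool; true; false; if_then_else_)
open import Data.Empty using (⊥; ⊥-elim)
open import Data.Fin using (Fin; zero; suc)
import Data.Fin.Properties as FinP
open import Data.List using (List; []; _∷_; _++_; map; length)
import Data.List as List
open import Data.List.Membership.Propositional using (_∈_)
open import Data.List.Membership.Propositional.Properties
  using (∈-map⁺; ∈-map⁻; ∈-++⁺ˡ; ∈-++⁺ʳ; ∈-++⁻; ∈-lookup)
open import Data.List.Properties using (map-++; map-∘; ++-assoc; ++-identityʳ)
import Data.List.Relation.Unary.All as All
open import Data.List.Relation.Unary.AllPairs using ([]; _∷_)
open import Data.List.Relation.Unary.Any using (here; there; index)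
open import Data.List.Relation.Unary.Any.Properties using (lookup-index)
open import Data.List.Relation.Unary.Unique.Propositional using (Unique)
open import Data.Maybe using (Maybe; just; nothing)
import Data.Maybe as May
open import Data.Nat using (ℕ; zero; suc; _*_)
import Data.Nat.Properties as ℕP
open import Data.Product using (Σ; ∃; _×_; _,_; proj₁; proj₂)
import Data.Product as Prod
open import Data.Product.Function.NonDependent.Propositional using (_×-↔_)
open import Data.Sum using (_⊎_; inj₁; inj₂)
import Data.Sum as Sum
open import Data.Sum.Properties using (inj₁-injective; inj₂-injective)
open import Data.Unit using (⊤; tt)
open import Data.Vec using (Vec; []; _∷_; lookup; _[_]≔_)
open import Function.Bundles using (_↔_; Inverse; mk↔ₛ′)
open import Function.Properties.Inverse using (↔-sym; ↔-trans)
open import Relation.Binary.PropositionalEquality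
open import Relation.Nullary using (Dec; yes; no)
open import Relation.Unary using (Irrelevant)

finite-↔ : ∀ {A B : Set} → A ↔ B → Finite A → Finite B
finite-↔ i (n , j) = n , ↔-trans (↔-sym i) j

finite-× : ∀ {A B : Set} → Finite A → Finite B → Finite (A × B)
finite-× (m , a) (n , b) = m * n , ↔-trans (a ×-↔ b) (↔-sym FinP.*↔×)

Σ-≡-irrelevant : ∀ {A : Set} {P : A → Set} → Irrelevant P → ∀ {a a' p p'} → a ≡ a' → _≡_ {A = Σ A P} (a , p) (a' , p')
Σ-≡-irrelevant irr {a} {p = p} {p'} refl = cong (a ,_) (irr p p')

cong-Σ-irrelevant : ∀ {A B X Y : Set} {f : A → X} {g : B → X} (h : Σ (A × B) (λ p → f (proj₁ p) ≡ g (proj₂ p)) → Y)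
         {a a' b b'} {pf : f a ≡ g b} {pf' : f a' ≡ g b'} → a ≡ a' → b ≡ b' → h ((a , b) , pf) ≡ h ((a' , b') , pf')
cong-Σ-irrelevant h {a} {_} {b} refl refl = cong (λ q → h ((a , b) , q)) (uip _ _)

finite-Σ-Fin : ∀ n (Q : Fin n → Set) → (∀ k → Dec (Q k)) → Irrelevant Q → Finite (Σ (Fin n) Q)
finite-Σ-Fin zero Q d irr = 0 , mk↔ₛ′ (λ { (() , _) }) (λ ()) (λ ()) (λ { (() , _) })
finite-Σ-Fin (suc n) Q d irr = finite-↔ iso (fin⊎ f0 (finite-Σ-Fin n (λ k → Q (suc k)) (λ k → d (suc k)) irr))
  where
  f0 : Finite (Q zero)
  f0 with d zero
  ... | yes q = finite-↔ (mk↔ₛ′ (λ _ → q) (λ _ → tt) (irr q) (λ _ → refl)) fin⊤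
  ... | no ¬q = finite-↔ (mk↔ₛ′ (λ ()) (λ x → ⊥-elim (¬q x)) (λ x → ⊥-elim (¬q x)) (λ ())) fin⊥
  to : (Q zero ⊎ Σ (Fin n) (λ k → Q (suc k))) → Σ (Fin (suc n)) Q
  to (inj₁ q) = zero , q
  to (inj₂ (k , q)) = suc k , q
  from : Σ (Fin (suc n)) Q → (Q zero ⊎ Σ (Fin n) (λ k → Q (suc k)))
  from (zero , q) = inj₁ q
  from (suc k , q) = inj₂ (k , q)
  iso : (Q zero ⊎ Σ (Fin n) (λ k → Q (suc k))) ↔ Σ (Fin (suc n)) Q
  iso = mk↔ₛ′ to from (λ { (zero , q) → refl ; (suc k , q) → refl }) (λ { (inj₁ q) → refl ; (inj₂ _) → refl })

finite-Σ : ∀ {A : Set} {P : A → Set} → Finite A → (∀ a → Dec (P a)) → Irrelevant P → Finite (Σ A P)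
finite-Σ {A} {P} (n , i) d irr =
  finite-↔ iso (finite-Σ-Fin n (λ k → P (Inverse.from i k)) (λ k → d _) irr)
  where
  iso : Σ (Fin n) (λ k → P (Inverse.from i k)) ↔ Σ A P
  iso = mk↔ₛ′ (λ { (k , p) → Inverse.from i k , p })
              (λ { (a , p) → Inverse.to i a , subst P (sym (Inverse.strictlyInverseʳ i a)) p })
              (λ { (a , p) → Σ-≡-irrelevant irr (Inverse.strictlyInverseʳ i a) })
              (λ { (k , p) → Σ-≡-irrelevant irr (Inverse.strictlyInverseˡ i k) })

lookup-injective : ∀ {A : Set} (xs : List (ℕ × A)) → Unique (map proj₁ xs) → ∀ j j' →
                   proj₁ (List.lookup xs j) ≡ proj₁ (List.lookup xs j') → j ≡ j'
lookup-injective (x ∷ xs) u zero zero e = refl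
lookup-injective (x ∷ xs) (x∉ ∷ u) zero (suc j') e = ⊥-elim (All.lookup x∉ (∈-map⁺ proj₁ (∈-lookup {xs = xs} j')) e)
lookup-injective (x ∷ xs) (x∉ ∷ u) (suc j) zero e = ⊥-elim (All.lookup x∉ (∈-map⁺ proj₁ (∈-lookup {xs = xs} j)) (sym e))
lookup-injective (x ∷ xs) (_ ∷ u) (suc j) (suc j') e = cong suc (lookup-injective xs u j j' e)

inj₁≢inj₂ : ∀ {A B : Set} {x : A} {y : B} → _≡_ {A = A ⊎ B} (inj₁ x) (inj₂ y) → ⊥
inj₁≢inj₂ ()

module FinGraphs (Sym : Set) where
  open Graphs Sym

  meet : Lab → Lab → Lab
  meet a top = a
  meet a (fsym _) = bot
  meet a (pos _) = bot
  meet a bot = bot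

  meet≤ˡ : ∀ a b → meet a b ≤L a
  meet≤ˡ a top = ≤refl
  meet≤ˡ a (fsym _) = bot≤
  meet≤ˡ a (pos _) = bot≤
  meet≤ˡ a bot = bot≤

  meet≤ʳ : ∀ a b → meet a b ≤L b
  meet≤ʳ a top = ≤top
  meet≤ʳ a (fsym _) = bot≤
  meet≤ʳ a (pos _) = bot≤
  meet≤ʳ a bot = bot≤

  BotOrTop : Lab → Set
  BotOrTop b = (b ≡ bot) ⊎ (b ≡ top)

  ≤bot⇒≡bot : ∀ {x} → x ≤L bot → x ≡ bot
  ≤bot⇒≡bot bot≤ = refl
  ≤bot⇒≡bot ≤refl = refl

  meet-glb : ∀ {x a b} → BotOrTop b → x ≤L a → x ≤L b → x ≤L meet a b
  meet-glb (inj₁ refl) p q rewrite ≤bot⇒≡bot q = bot≤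
  meet-glb (inj₂ refl) p q = p

  meet-top : ∀ a {b} → b ≡ top → meet a b ≡ a
  meet-top a refl = refl

  ≤L-respʳ-≡ : ∀ {x y z} → x ≤L y → y ≡ z → x ≤L z
  ≤L-respʳ-≡ p refl = p

  ≤L-respˡ-≡ : ∀ {x y z} → x ≡ y → y ≤L z → x ≤L z
  ≤L-respˡ-≡ refl p = p

  injective⇒Mono : ∀ {A B} (m : Hom A B) → (∀ x y → fV m x ≡ fV m y → x ≡ y) →
            (∀ x y → fE m x ≡ fE m y → x ≡ y) → Mono m
  injective⇒Mono m iV iE a b (eV , eE) = (λ v → iV _ _ (eV v)) , (λ e → iE _ _ (eE e))

  -- Pairs of labels are combined by meet, which is a greatest lower bound only when
  -- the K'-side label is ⊥ or ⊤; the labels of every K' of R° are of this form.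
  module Pullback {G L' K' : Graph} (α : Hom G L') (l' : Hom K' L') (bt : ∀ v → BotOrTop (lV K' v)) (btE : ∀ e → BotOrTop (lE K' e)) where
    PV : Set
    PV = Σ (V G × V K') (λ p → fV α (proj₁ p) ≡ fV l' (proj₂ p))
    PE : Set
    PE = Σ (E G × E K') (λ p → fE α (proj₁ p) ≡ fE l' (proj₂ p))

    psrc : PE → PV
    psrc ((e , e') , q) = (src G e , src K' e') , trans (srcC α e) (trans (cong (src L') q) (sym (srcC l' e')))
    ptgt : PE → PV
    ptgt ((e , e') , q) = (tgt G e , tgt K' e') , trans (tgtC α e) (trans (cong (tgt L') q) (sym (tgtC l' e')))

    GK : Graph
    GK = record
      { V = PV ; E = PE
      ; finV = finite-Σ (finite-× (finV G) (finV K')) (λ p → finDec (finV L') _ _) uip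
      ; finE = finite-Σ (finite-× (finE G) (finE K')) (λ p → finDec (finE L') _ _) uip
      ; src = psrc ; tgt = ptgt
      ; lV = λ p → meet (lV G (proj₁ (proj₁ p))) (lV K' (proj₂ (proj₁ p)))
      ; lE = λ p → meet (lE G (proj₁ (proj₁ p))) (lE K' (proj₂ (proj₁ p)))
      }

    gL : Hom GK G
    gL = record { fV = λ p → proj₁ (proj₁ p) ; fE = λ p → proj₁ (proj₁ p)
                ; srcC = λ _ → refl ; tgtC = λ _ → refl
                ; lV≤ = λ p → meet≤ˡ _ _ ; lE≤ = λ p → meet≤ˡ _ _ }

    u' : Hom GK K'
    u' = record { fV = λ p → proj₂ (proj₁ p) ; fE = λ p → proj₂ (proj₁ p)
                ; srcC = λ _ → refl ; tgtC = λ _ → refl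
                ; lV≤ = λ p → meet≤ʳ _ _ ; lE≤ = λ p → meet≤ʳ _ _ }

    PV-≡ : ∀ {k k' : PV} → proj₁ k ≡ proj₁ k' → k ≡ k'
    PV-≡ = Σ-≡-irrelevant uip
    PE-≡ : ∀ {k k' : PE} → proj₁ k ≡ proj₁ k' → k ≡ k'
    PE-≡ = Σ-≡-irrelevant uip

    isPullback : IsPullback α l' gL u'
    isPullback = ((λ p → proj₂ p) , (λ p → proj₂ p)) , univ
      where
      univ : ∀ (Q : Graph) (p₁ : Hom Q G) (q₁ : Hom Q K') → α ∘H p₁ ≈H l' ∘H q₁ →
             Σ (Hom Q GK) λ h → (gL ∘H h ≈H p₁) × (u' ∘H h ≈H q₁) ×
               (∀ (h' : Hom Q GK) → gL ∘H h' ≈H p₁ → u' ∘H h' ≈H q₁ → h' ≈H h)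
      univ Q p₁ q₁ (cV , cE) = h , ((λ _ → refl) , (λ _ → refl)) , ((λ _ → refl) , (λ _ → refl)) , uniq
        where
        h : Hom Q GK
        h = record
          { fV = λ v → (fV p₁ v , fV q₁ v) , cV v
          ; fE = λ e → (fE p₁ e , fE q₁ e) , cE e
          ; srcC = λ e → PV-≡ (cong₂ _,_ (srcC p₁ e) (srcC q₁ e))
          ; tgtC = λ e → PV-≡ (cong₂ _,_ (tgtC p₁ e) (tgtC q₁ e))
          ; lV≤ = λ v → meet-glb (bt _) (lV≤ p₁ v) (lV≤ q₁ v)
          ; lE≤ = λ e → meet-glb (btE _) (lE≤ p₁ e) (lE≤ q₁ e) }
        uniq : ∀ (h' : Hom Q GK) → gL ∘H h' ≈H p₁ → u' ∘H h' ≈H q₁ → h' ≈H h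
        uniq h' (a1 , a2) (b1 , b2) = (λ v → PV-≡ (cong₂ _,_ (a1 v) (b1 v))) , (λ e → PE-≡ (cong₂ _,_ (a2 e) (b2 e)))

LocatedRule : (S : Signature) → TRSDefs.Rule S → Set
LocatedRule S ρ = ∀ j → ∃ λ φ → Encoding.Enc.loc S ρ j ≡ just φ

module StepWitnesses (S : Signature) (ρ : TRSDefs.Rule S) (lo : LocatedRule S ρ) where
  open Signature S
  open Encoding S
  open FinGraphs Sym
  open Enc ρ

  K'lV-BotOrTop : ∀ v → BotOrTop (lV K'g v)
  K'lV-BotOrTop (inj₁ v) with isVarV Kg inj₂ v
  ... | yes _ = inj₂ refl
  ... | no _ = inj₁ refl
  K'lV-BotOrTop (inj₂ v) = inj₂ refl

  K'lE-BotOrTop : ∀ e → BotOrTop (lE K'g e)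
  K'lE-BotOrTop (inj₁ ())
  K'lE-BotOrTop (inj₂ e) = inj₂ refl

  tL∘l≗l'∘tK : ∀ x → inj₁ (fV lHom x) ≡ l'V (inj₁ x)
  tL∘l≗l'∘tK (inj₁ tt) = refl
  tL∘l≗l'∘tK (inj₂ j) with loc j | lo j
  ... | just φ | _ = refl
  ... | nothing | (_ , ())

  -- reflV and reflE say α⁻¹(t_L L) = m L, which is what makes (L, 1, m) a pullback of t_L and α.
  record Witness (G H : Graph) : Set₁ where
    field
      m : Hom GL G
      mInjV : ∀ x y → fV m x ≡ fV m y → x ≡ y
      mInjE : ∀ x y → fE m x ≡ fE m y → x ≡ y
      α : Hom G L'g
      αmV : ∀ z → fV α (fV m z) ≡ inj₁ z
      αmE : ∀ z → fE α (fE m z) ≡ inj₁ z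
      reflV : ∀ a z → fV α a ≡ inj₁ z → a ≡ fV m z
      reflE : ∀ e z → fE α e ≡ inj₁ z → e ≡ fE m z
    open Pullback α l'Hom K'lV-BotOrTop K'lE-BotOrTop public
    uK : Hom Kg GK
    uK = record
      { fV = λ x → (fV m (fV lHom x) , inj₁ x) , trans (αmV _) (tL∘l≗l'∘tK x)
      ; fE = λ () ; srcC = λ () ; tgtC = λ () ; lV≤ = λ _ → bot≤ ; lE≤ = λ () }
    field
      w : Hom GK H
      v : Hom GR H
      po : IsPushout uK rHom w v

  Witness⇒PBPOStep : ∀ {G H} → Witness G H → PBPOStep (ρ °) G H
  Witness⇒PBPOStep {G} rs =
    m , injective⇒Mono m mInjV mInjE , α , (αmV , αmE) , matchPullback ,
    GK , gL , u' , isPullback , uK , ((λ _ → refl) , (λ ())) , ((λ _ → refl) , (λ ())) ,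
    w , v , po
    where
    open Witness rs
    matchPullback : IsPullback tLHom α (idH {GL}) m
    matchPullback = ((λ z → sym (αmV z)) , (λ z → sym (αmE z))) , univ
      where
      univ : ∀ (Q : Graph) (p₁ : Hom Q GL) (q₁ : Hom Q G) → tLHom ∘H p₁ ≈H α ∘H q₁ →
             Σ (Hom Q GL) λ h → (idH ∘H h ≈H p₁) × (m ∘H h ≈H q₁) ×
               (∀ (h' : Hom Q GL) → idH ∘H h' ≈H p₁ → m ∘H h' ≈H q₁ → h' ≈H h)
      univ Q p₁ q₁ (cV , cE) = p₁ , ((λ _ → refl) , (λ _ → refl)) ,
        ((λ v → sym (reflV _ _ (sym (cV v)))) , (λ e → sym (reflE _ _ (sym (cE e))))) ,
        (λ h' e1 e2 → e1)

  𝒞K : V K'g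
  𝒞K = inj₂ (inj₂ tt)
  𝒞loopK : E K'g
  𝒞loopK = inj₂ (inj₂ (inj₂ tt))
  𝒞rootK : E K'g
  𝒞rootK = inj₂ (inj₂ (inj₁ tt))
  𝒞rootL : E L'g
  𝒞rootL = inj₂ (inj₂ (inj₁ tt))

  l'V-𝒞⁻¹ : ∀ b → l'V b ≡ Cv → b ≡ 𝒞K
  l'V-𝒞⁻¹ (inj₁ (inj₁ tt)) ()
  l'V-𝒞⁻¹ (inj₁ (inj₂ j)) e with loc j | lo j
  l'V-𝒞⁻¹ (inj₁ (inj₂ j)) () | just φ | _
  l'V-𝒞⁻¹ (inj₁ (inj₂ j)) e | nothing | (_ , ())
  l'V-𝒞⁻¹ (inj₂ (inj₁ j)) e with loc j | lo j
  l'V-𝒞⁻¹ (inj₂ (inj₁ j)) () | just φ | _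
  l'V-𝒞⁻¹ (inj₂ (inj₁ j)) e | nothing | (_ , ())
  l'V-𝒞⁻¹ (inj₂ (inj₂ tt)) e = refl

  l'E-𝒞loop⁻¹ : ∀ b → l'E b ≡ CCe → b ≡ 𝒞loopK
  l'E-𝒞loop⁻¹ (inj₁ ())
  l'E-𝒞loop⁻¹ (inj₂ (inj₁ (inj₁ j))) e with loc j | lo j
  l'E-𝒞loop⁻¹ (inj₂ (inj₁ (inj₁ j))) () | just φ | _
  l'E-𝒞loop⁻¹ (inj₂ (inj₁ (inj₁ j))) e | nothing | (_ , ())
  l'E-𝒞loop⁻¹ (inj₂ (inj₁ (inj₂ j))) e with loc j | lo j
  l'E-𝒞loop⁻¹ (inj₂ (inj₁ (inj₂ j))) () | just φ | _
  l'E-𝒞loop⁻¹ (inj₂ (inj₁ (inj₂ j))) e | nothing | (_ , ())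
  l'E-𝒞loop⁻¹ (inj₂ (inj₂ (inj₁ tt))) ()
  l'E-𝒞loop⁻¹ (inj₂ (inj₂ (inj₂ tt))) e = refl

  l'E-𝒞root⁻¹ : ∀ b → l'E b ≡ 𝒞rootL → b ≡ 𝒞rootK
  l'E-𝒞root⁻¹ (inj₁ ())
  l'E-𝒞root⁻¹ (inj₂ (inj₁ (inj₁ j))) e with loc j | lo j
  l'E-𝒞root⁻¹ (inj₂ (inj₁ (inj₁ j))) () | just φ | _
  l'E-𝒞root⁻¹ (inj₂ (inj₁ (inj₁ j))) e | nothing | (_ , ())
  l'E-𝒞root⁻¹ (inj₂ (inj₁ (inj₂ j))) e with loc j | lo j
  l'E-𝒞root⁻¹ (inj₂ (inj₁ (inj₂ j))) () | just φ | _
  l'E-𝒞root⁻¹ (inj₂ (inj₁ (inj₂ j))) e | nothing | (_ , ())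
  l'E-𝒞root⁻¹ (inj₂ (inj₂ (inj₁ tt))) e = refl
  l'E-𝒞root⁻¹ (inj₂ (inj₂ (inj₂ tt))) ()

  -- The root of the rewritten graph is the image of the rule's root or of the context vertex 𝒞,
  -- so an edge from a parent into it can be matched by the edge 𝒞 → root or by the loop on 𝒞.
  RootTracked : ∀ {G H} (rs : Witness G H) → V G → V H → Set
  RootTracked rs c c' =
    (Σ (fV α c ≡ inj₁ (rt Lt)) λ pf → fV w ((c , inj₁ (inj₁ tt)) , pf) ≡ c') ⊎
    (Σ (fV α c ≡ Cv) λ pf → fV w ((c , 𝒞K) , pf) ≡ c')
    where open Witness rs

  -- A step inside the child C of 'attach T lam C': all of T is sent to 𝒞 and its edges to the loop on 𝒞.
  module LiftBelow (T C C' : TG) (lam : Lab) (rs : Witness (g C) (g C')) (ri : RootTracked rs (rt C) (rt C')) where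
    module I = Witness rs
    G G' : Graph
    G = g (attach T lam C)
    G' = g (attach T lam C')
    RootTracked-C : Set
    RootTracked-C = RootTracked rs (rt C) (rt C')

    rootEdgeL : RootTracked-C → E L'g
    rootEdgeL (inj₁ _) = 𝒞rootL
    rootEdgeL (inj₂ _) = CCe
    rootEdgeK : RootTracked-C → E K'g
    rootEdgeK (inj₁ _) = 𝒞rootK
    rootEdgeK (inj₂ _) = 𝒞loopK
    rootEdgeL≡l'E : ∀ x → rootEdgeL x ≡ l'E (rootEdgeK x)
    rootEdgeL≡l'E (inj₁ _) = refl
    rootEdgeL≡l'E (inj₂ _) = refl
    src-rootEdgeK : ∀ x → src K'g (rootEdgeK x) ≡ 𝒞K
    src-rootEdgeK (inj₁ _) = refl
    src-rootEdgeK (inj₂ _) = refl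
    lE-rootEdgeK : ∀ x → lE K'g (rootEdgeK x) ≡ top
    lE-rootEdgeK (inj₁ _) = refl
    lE-rootEdgeK (inj₂ _) = refl
    src-rootEdgeL : ∀ x → Cv ≡ src L'g (rootEdgeL x)
    src-rootEdgeL (inj₁ _) = refl
    src-rootEdgeL (inj₂ _) = refl
    tgt-rootEdgeL : ∀ x → fV I.α (rt C) ≡ tgt L'g (rootEdgeL x)
    tgt-rootEdgeL (inj₁ (pf , _)) = pf
    tgt-rootEdgeL (inj₂ (pf , _)) = pf
    lE-rootEdgeL : ∀ x → lE L'g (rootEdgeL x) ≡ top
    lE-rootEdgeL (inj₁ _) = refl
    lE-rootEdgeL (inj₂ _) = refl
    rootEdgeL≢inj₁ : ∀ x z → rootEdgeL x ≡ inj₁ z → ⊥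
    rootEdgeL≢inj₁ (inj₁ _) z ()
    rootEdgeL≢inj₁ (inj₂ _) z ()
    rootEdgeK-unique : ∀ x b → rootEdgeL x ≡ l'E b → b ≡ rootEdgeK x
    rootEdgeK-unique (inj₁ _) b q = l'E-𝒞root⁻¹ b (sym q)
    rootEdgeK-unique (inj₂ _) b q = l'E-𝒞loop⁻¹ b (sym q)
    wroot : ∀ x b → rootEdgeL x ≡ l'E b → ∀ pf → fV I.w ((rt C , tgt K'g b) , pf) ≡ rt C'
    wroot (inj₁ (pf0 , e0)) b q pf with l'E-𝒞root⁻¹ b (sym q)
    ... | refl = trans (cong-Σ-irrelevant (fV I.w) refl refl) e0
    wroot (inj₂ (pf0 , e0)) b q pf with l'E-𝒞loop⁻¹ b (sym q)
    ... | refl = trans (cong-Σ-irrelevant (fV I.w) refl refl) e0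

    αV' : V G → V L'g
    αV' (inj₁ t) = Cv
    αV' (inj₂ c) = fV I.α c
    αE' : E G → E L'g
    αE' (inj₁ e) = CCe
    αE' (inj₂ (inj₁ e)) = fE I.α e
    αE' (inj₂ (inj₂ tt)) = rootEdgeL ri

    α' : Hom G L'g
    α' = record
      { fV = αV' ; fE = αE'
      ; srcC = λ { (inj₁ e) → refl ; (inj₂ (inj₁ e)) → srcC I.α e ; (inj₂ (inj₂ tt)) → src-rootEdgeL ri }
      ; tgtC = λ { (inj₁ e) → refl ; (inj₂ (inj₁ e)) → tgtC I.α e ; (inj₂ (inj₂ tt)) → tgt-rootEdgeL ri }
      ; lV≤ = λ { (inj₁ t) → ≤top ; (inj₂ c) → lV≤ I.α c }
      ; lE≤ = λ { (inj₁ e) → ≤top ; (inj₂ (inj₁ e)) → lE≤ I.α e ; (inj₂ (inj₂ tt)) → ≤L-respʳ-≡ ≤top (sym (lE-rootEdgeL ri)) } }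

    m' : Hom GL G
    m' = record
      { fV = λ z → inj₂ (fV I.m z) ; fE = λ z → inj₂ (inj₁ (fE I.m z))
      ; srcC = λ e → cong inj₂ (srcC I.m e) ; tgtC = λ e → cong inj₂ (tgtC I.m e)
      ; lV≤ = lV≤ I.m ; lE≤ = lE≤ I.m }

    module P' = Pullback α' l'Hom K'lV-BotOrTop K'lE-BotOrTop

    incl : Hom I.GK P'.GK
    incl = record
      { fV = λ { ((c , b) , pf) → (inj₂ c , b) , pf }
      ; fE = λ { ((e , b) , pf) → (inj₂ (inj₁ e) , b) , pf }
      ; srcC = λ { ((e , b) , pf) → cong-Σ-irrelevant (λ z → z) refl refl }
      ; tgtC = λ { ((e , b) , pf) → cong-Σ-irrelevant (λ z → z) refl refl }
      ; lV≤ = λ _ → ≤refl ; lE≤ = λ _ → ≤refl }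

    wV : P'.PV → V G'
    wV ((inj₁ t , b) , pf) = inj₁ t
    wV ((inj₂ c , b) , pf) = inj₂ (fV I.w ((c , b) , pf))
    wE : P'.PE → E G'
    wE ((inj₁ e , b) , pf) = inj₁ e
    wE ((inj₂ (inj₁ e) , b) , pf) = inj₂ (inj₁ (fE I.w ((e , b) , pf)))
    wE ((inj₂ (inj₂ tt) , b) , pf) = inj₂ (inj₂ tt)

    wsrc : ∀ e → wV (P'.psrc e) ≡ src G' (wE e)
    wsrc ((inj₁ e , b) , pf) = refl
    wsrc ((inj₂ (inj₁ e) , b) , pf) = cong inj₂ (trans (cong-Σ-irrelevant (fV I.w) refl refl) (srcC I.w ((e , b) , pf)))
    wsrc ((inj₂ (inj₂ tt) , b) , pf) = refl
    wtgt : ∀ e → wV (P'.ptgt e) ≡ tgt G' (wE e)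
    wtgt ((inj₁ e , b) , pf) = refl
    wtgt ((inj₂ (inj₁ e) , b) , pf) = cong inj₂ (trans (cong-Σ-irrelevant (fV I.w) refl refl) (tgtC I.w ((e , b) , pf)))
    wtgt ((inj₂ (inj₂ tt) , b) , pf) = cong inj₂ (wroot ri b pf _)
    wlV : ∀ x → lV P'.GK x ≤L lV G' (wV x)
    wlV ((inj₁ t , b) , pf) = meet≤ˡ _ _
    wlV ((inj₂ c , b) , pf) = lV≤ I.w ((c , b) , pf)
    wlE : ∀ x → lE P'.GK x ≤L lE G' (wE x)
    wlE ((inj₁ e , b) , pf) = meet≤ˡ _ _
    wlE ((inj₂ (inj₁ e) , b) , pf) = lE≤ I.w ((e , b) , pf)
    wlE ((inj₂ (inj₂ tt) , b) , pf) = meet≤ˡ _ _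

    w' : Hom P'.GK G'
    w' = record { fV = wV ; fE = wE ; srcC = wsrc ; tgtC = wtgt ; lV≤ = wlV ; lE≤ = wlE }

    v' : Hom GR G'
    v' = record
      { fV = λ z → inj₂ (fV I.v z) ; fE = λ z → inj₂ (inj₁ (fE I.v z))
      ; srcC = λ e → cong inj₂ (srcC I.v e) ; tgtC = λ e → cong inj₂ (tgtC I.v e)
      ; lV≤ = lV≤ I.v ; lE≤ = lE≤ I.v }

    uK' : Hom Kg P'.GK
    uK' = record
      { fV = λ x → (inj₂ (fV I.m (fV lHom x)) , inj₁ x) , trans (I.αmV _) (tL∘l≗l'∘tK x)
      ; fE = λ () ; srcC = λ () ; tgtC = λ () ; lV≤ = λ _ → bot≤ ; lE≤ = λ () }

    po' : IsPushout uK' rHom w' v'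
    po' = ((λ x → cong inj₂ (trans (cong-Σ-irrelevant (fV I.w) refl refl) (proj₁ (proj₁ I.po) x))) , (λ ())) , univ
      where
      univ : ∀ (Q : Graph) (p₁ : Hom P'.GK Q) (q₁ : Hom GR Q) → p₁ ∘H uK' ≈H q₁ ∘H rHom →
             Σ (Hom G' Q) λ h → (h ∘H w' ≈H p₁) × (h ∘H v' ≈H q₁) ×
               (∀ (h' : Hom G' Q) → h' ∘H w' ≈H p₁ → h' ∘H v' ≈H q₁ → h' ≈H h)
      univ Q p₁ q₁ (cV , cE) = h , (hwV , hwE) , ((λ y → proj₁ hiv y) , (λ e → proj₂ hiv e)) , uniq
        where
        p₁i : Hom I.GK Q
        p₁i = p₁ ∘H incl
        cond : p₁i ∘H I.uK ≈H q₁ ∘H rHom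
        cond = (λ x → trans (cong-Σ-irrelevant (fV p₁) refl refl) (cV x)) , (λ ())
        hi : Hom (g C') Q
        hi = proj₁ (proj₂ I.po Q p₁i q₁ cond)
        hiw : hi ∘H I.w ≈H p₁i
        hiw = proj₁ (proj₂ (proj₂ I.po Q p₁i q₁ cond))
        hiv : hi ∘H I.v ≈H q₁
        hiv = proj₁ (proj₂ (proj₂ (proj₂ I.po Q p₁i q₁ cond)))
        hiu : ∀ (h' : Hom (g C') Q) → h' ∘H I.w ≈H p₁i → h' ∘H I.v ≈H q₁ → h' ≈H hi
        hiu = proj₂ (proj₂ (proj₂ (proj₂ I.po Q p₁i q₁ cond)))
        rootEdgeGK : P'.PE
        rootEdgeGK = (inj₂ (inj₂ tt) , rootEdgeK ri) , rootEdgeL≡l'E ri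
        hV : V G' → V Q
        hV (inj₁ t) = fV p₁ ((inj₁ t , 𝒞K) , refl)
        hV (inj₂ c) = fV hi c
        hE : E G' → E Q
        hE (inj₁ e) = fE p₁ ((inj₁ e , 𝒞loopK) , refl)
        hE (inj₂ (inj₁ e)) = fE hi e
        hE (inj₂ (inj₂ tt)) = fE p₁ rootEdgeGK
        hsrc : ∀ e → hV (src G' e) ≡ src Q (hE e)
        hsrc (inj₁ e) = trans (cong-Σ-irrelevant (fV p₁) refl refl) (srcC p₁ _)
        hsrc (inj₂ (inj₁ e)) = srcC hi e
        hsrc (inj₂ (inj₂ tt)) = trans (cong-Σ-irrelevant (fV p₁) refl (sym (src-rootEdgeK ri))) (srcC p₁ rootEdgeGK)
        htgt : ∀ e → hV (tgt G' e) ≡ tgt Q (hE e)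
        htgt (inj₁ e) = trans (cong-Σ-irrelevant (fV p₁) refl refl) (tgtC p₁ _)
        htgt (inj₂ (inj₁ e)) = tgtC hi e
        htgt (inj₂ (inj₂ tt)) =
          trans (cong (fV hi) (sym (wroot ri (rootEdgeK ri) (rootEdgeL≡l'E ri) (proj₂ (P'.ptgt rootEdgeGK)))))
                (trans (proj₁ hiw _) (tgtC p₁ rootEdgeGK))
        hlV : ∀ x → lV G' x ≤L lV Q (hV x)
        hlV (inj₁ t) = lV≤ p₁ ((inj₁ t , 𝒞K) , refl)
        hlV (inj₂ c) = lV≤ hi c
        hlE : ∀ x → lE G' x ≤L lE Q (hE x)
        hlE (inj₁ e) = lE≤ p₁ ((inj₁ e , 𝒞loopK) , refl)
        hlE (inj₂ (inj₁ e)) = lE≤ hi e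
        hlE (inj₂ (inj₂ tt)) = ≤L-respˡ-≡ (sym (meet-top lam (lE-rootEdgeK ri))) (lE≤ p₁ rootEdgeGK)
        h : Hom G' Q
        h = record { fV = hV ; fE = hE ; srcC = hsrc ; tgtC = htgt ; lV≤ = hlV ; lE≤ = hlE }
        hwV : ∀ x → hV (wV x) ≡ fV p₁ x
        hwV ((inj₁ t , b) , pf) = cong-Σ-irrelevant (fV p₁) refl (sym (l'V-𝒞⁻¹ b (sym pf)))
        hwV ((inj₂ c , b) , pf) = proj₁ hiw ((c , b) , pf)
        hwE : ∀ x → hE (wE x) ≡ fE p₁ x
        hwE ((inj₁ e , b) , pf) = cong-Σ-irrelevant (fE p₁) refl (sym (l'E-𝒞loop⁻¹ b (sym pf)))
        hwE ((inj₂ (inj₁ e) , b) , pf) = proj₂ hiw ((e , b) , pf)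
        hwE ((inj₂ (inj₂ tt) , b) , pf) = cong-Σ-irrelevant (fE p₁) refl (sym (rootEdgeK-unique ri b pf))
        inR : Hom (g C') G'
        inR = record { fV = inj₂ ; fE = λ e → inj₂ (inj₁ e) ; srcC = λ _ → refl ; tgtC = λ _ → refl
                     ; lV≤ = λ _ → ≤refl ; lE≤ = λ _ → ≤refl }
        uniq : ∀ (h' : Hom G' Q) → h' ∘H w' ≈H p₁ → h' ∘H v' ≈H q₁ → h' ≈H h
        uniq h' (e1V , e1E) (e2V , e2E) = uV , uE
          where
          hu : h' ∘H inR ≈H hi
          hu = hiu (h' ∘H inR) ((λ k → e1V (fV incl k)) , (λ k → e1E (fE incl k))) (e2V , e2E)
          uV : ∀ x → fV h' x ≡ hV x
          uV (inj₁ t) = e1V ((inj₁ t , 𝒞K) , refl)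
          uV (inj₂ c) = proj₁ hu c
          uE : ∀ x → fE h' x ≡ hE x
          uE (inj₁ e) = e1E ((inj₁ e , 𝒞loopK) , refl)
          uE (inj₂ (inj₁ e)) = proj₂ hu e
          uE (inj₂ (inj₂ tt)) = e1E rootEdgeGK

    lifted : Witness G G'
    lifted = record
      { m = m'
      ; mInjV = λ x y e → I.mInjV x y (inj₂-injective e)
      ; mInjE = λ x y e → I.mInjE x y (inj₁-injective (inj₂-injective e))
      ; α = α'
      ; αmV = I.αmV ; αmE = I.αmE
      ; reflV = λ { (inj₁ t) z () ; (inj₂ c) z q → cong inj₂ (I.reflV c z q) }
      ; reflE = λ { (inj₁ e) z () ; (inj₂ (inj₁ e)) z q → cong (λ x → inj₂ (inj₁ x)) (I.reflE e z q)
                  ; (inj₂ (inj₂ tt)) z q → ⊥-elim (rootEdgeL≢inj₁ ri z q) }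
      ; w = w' ; v = v' ; po = po' }

  -- A step inside T whose root is tracked by 𝒞: the untouched child C is sent to 𝒞 as well.
  module LiftAbove (T T' C : TG) (lam : Lab) (rs : Witness (g T) (g T'))
            (pf0 : fV (Witness.α rs) (rt T) ≡ Cv) (e0 : fV (Witness.w rs) ((rt T , 𝒞K) , pf0) ≡ rt T') where
    module I = Witness rs
    G G' : Graph
    G = g (attach T lam C)
    G' = g (attach T' lam C)

    αV' : V G → V L'g
    αV' (inj₁ t) = fV I.α t
    αV' (inj₂ c) = Cv
    αE' : E G → E L'g
    αE' (inj₁ e) = fE I.α e
    αE' (inj₂ (inj₁ e)) = CCe
    αE' (inj₂ (inj₂ tt)) = CCe

    α' : Hom G L'g
    α' = record
      { fV = αV' ; fE = αE'
      ; srcC = λ { (inj₁ e) → srcC I.α e ; (inj₂ (inj₁ e)) → refl ; (inj₂ (inj₂ tt)) → pf0 }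
      ; tgtC = λ { (inj₁ e) → tgtC I.α e ; (inj₂ (inj₁ e)) → refl ; (inj₂ (inj₂ tt)) → refl }
      ; lV≤ = λ { (inj₁ t) → lV≤ I.α t ; (inj₂ c) → ≤top }
      ; lE≤ = λ { (inj₁ e) → lE≤ I.α e ; (inj₂ (inj₁ e)) → ≤top ; (inj₂ (inj₂ tt)) → ≤top } }

    m' : Hom GL G
    m' = record
      { fV = λ z → inj₁ (fV I.m z) ; fE = λ z → inj₁ (fE I.m z)
      ; srcC = λ e → cong inj₁ (srcC I.m e) ; tgtC = λ e → cong inj₁ (tgtC I.m e)
      ; lV≤ = lV≤ I.m ; lE≤ = lE≤ I.m }

    module P' = Pullback α' l'Hom K'lV-BotOrTop K'lE-BotOrTop

    incl : Hom I.GK P'.GK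
    incl = record
      { fV = λ { ((c , b) , pf) → (inj₁ c , b) , pf }
      ; fE = λ { ((e , b) , pf) → (inj₁ e , b) , pf }
      ; srcC = λ { ((e , b) , pf) → cong-Σ-irrelevant (λ z → z) refl refl }
      ; tgtC = λ { ((e , b) , pf) → cong-Σ-irrelevant (λ z → z) refl refl }
      ; lV≤ = λ _ → ≤refl ; lE≤ = λ _ → ≤refl }

    wV : P'.PV → V G'
    wV ((inj₁ t , b) , pf) = inj₁ (fV I.w ((t , b) , pf))
    wV ((inj₂ c , b) , pf) = inj₂ c
    wE : P'.PE → E G'
    wE ((inj₁ e , b) , pf) = inj₁ (fE I.w ((e , b) , pf))
    wE ((inj₂ (inj₁ e) , b) , pf) = inj₂ (inj₁ e)
    wE ((inj₂ (inj₂ tt) , b) , pf) = inj₂ (inj₂ tt)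

    wconn : ∀ b → CCe ≡ l'E b → ∀ pf → fV I.w ((rt T , src K'g b) , pf) ≡ rt T'
    wconn b q pf with l'E-𝒞loop⁻¹ b (sym q)
    ... | refl = trans (cong-Σ-irrelevant (fV I.w) refl refl) e0

    wsrc : ∀ e → wV (P'.psrc e) ≡ src G' (wE e)
    wsrc ((inj₁ e , b) , pf) = cong inj₁ (trans (cong-Σ-irrelevant (fV I.w) refl refl) (srcC I.w ((e , b) , pf)))
    wsrc ((inj₂ (inj₁ e) , b) , pf) = refl
    wsrc ((inj₂ (inj₂ tt) , b) , pf) = cong inj₁ (wconn b pf _)
    wtgt : ∀ e → wV (P'.ptgt e) ≡ tgt G' (wE e)
    wtgt ((inj₁ e , b) , pf) = cong inj₁ (trans (cong-Σ-irrelevant (fV I.w) refl refl) (tgtC I.w ((e , b) , pf)))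
    wtgt ((inj₂ (inj₁ e) , b) , pf) = refl
    wtgt ((inj₂ (inj₂ tt) , b) , pf) = refl
    wlV : ∀ x → lV P'.GK x ≤L lV G' (wV x)
    wlV ((inj₁ t , b) , pf) = lV≤ I.w ((t , b) , pf)
    wlV ((inj₂ c , b) , pf) = meet≤ˡ _ _
    wlE : ∀ x → lE P'.GK x ≤L lE G' (wE x)
    wlE ((inj₁ e , b) , pf) = lE≤ I.w ((e , b) , pf)
    wlE ((inj₂ (inj₁ e) , b) , pf) = meet≤ˡ _ _
    wlE ((inj₂ (inj₂ tt) , b) , pf) = meet≤ˡ _ _

    w' : Hom P'.GK G'
    w' = record { fV = wV ; fE = wE ; srcC = wsrc ; tgtC = wtgt ; lV≤ = wlV ; lE≤ = wlE }

    v' : Hom GR G'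
    v' = record
      { fV = λ z → inj₁ (fV I.v z) ; fE = λ z → inj₁ (fE I.v z)
      ; srcC = λ e → cong inj₁ (srcC I.v e) ; tgtC = λ e → cong inj₁ (tgtC I.v e)
      ; lV≤ = lV≤ I.v ; lE≤ = lE≤ I.v }

    uK' : Hom Kg P'.GK
    uK' = record
      { fV = λ x → (inj₁ (fV I.m (fV lHom x)) , inj₁ x) , trans (I.αmV _) (tL∘l≗l'∘tK x)
      ; fE = λ () ; srcC = λ () ; tgtC = λ () ; lV≤ = λ _ → bot≤ ; lE≤ = λ () }

    po' : IsPushout uK' rHom w' v'
    po' = ((λ x → cong inj₁ (trans (cong-Σ-irrelevant (fV I.w) refl refl) (proj₁ (proj₁ I.po) x))) , (λ ())) , univ
      where
      univ : ∀ (Q : Graph) (p₁ : Hom P'.GK Q) (q₁ : Hom GR Q) → p₁ ∘H uK' ≈H q₁ ∘H rHom →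
             Σ (Hom G' Q) λ h → (h ∘H w' ≈H p₁) × (h ∘H v' ≈H q₁) ×
               (∀ (h' : Hom G' Q) → h' ∘H w' ≈H p₁ → h' ∘H v' ≈H q₁ → h' ≈H h)
      univ Q p₁ q₁ (cV , cE) = h , (hwV , hwE) , ((λ y → proj₁ hiv y) , (λ e → proj₂ hiv e)) , uniq
        where
        p₁i : Hom I.GK Q
        p₁i = p₁ ∘H incl
        cond : p₁i ∘H I.uK ≈H q₁ ∘H rHom
        cond = (λ x → trans (cong-Σ-irrelevant (fV p₁) refl refl) (cV x)) , (λ ())
        hi : Hom (g T') Q
        hi = proj₁ (proj₂ I.po Q p₁i q₁ cond)
        hiw : hi ∘H I.w ≈H p₁i
        hiw = proj₁ (proj₂ (proj₂ I.po Q p₁i q₁ cond))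
        hiv : hi ∘H I.v ≈H q₁
        hiv = proj₁ (proj₂ (proj₂ (proj₂ I.po Q p₁i q₁ cond)))
        hiu : ∀ (h' : Hom (g T') Q) → h' ∘H I.w ≈H p₁i → h' ∘H I.v ≈H q₁ → h' ≈H hi
        hiu = proj₂ (proj₂ (proj₂ (proj₂ I.po Q p₁i q₁ cond)))
        rootEdgeGK : P'.PE
        rootEdgeGK = (inj₂ (inj₂ tt) , 𝒞loopK) , refl
        hV : V G' → V Q
        hV (inj₁ t) = fV hi t
        hV (inj₂ c) = fV p₁ ((inj₂ c , 𝒞K) , refl)
        hE : E G' → E Q
        hE (inj₁ e) = fE hi e
        hE (inj₂ (inj₁ e)) = fE p₁ ((inj₂ (inj₁ e) , 𝒞loopK) , refl)
        hE (inj₂ (inj₂ tt)) = fE p₁ rootEdgeGK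
        hsrc : ∀ e → hV (src G' e) ≡ src Q (hE e)
        hsrc (inj₁ e) = srcC hi e
        hsrc (inj₂ (inj₁ e)) = trans (cong-Σ-irrelevant (fV p₁) refl refl) (srcC p₁ _)
        hsrc (inj₂ (inj₂ tt)) =
          trans (cong (fV hi) (sym e0)) (trans (proj₁ hiw _) (trans (cong-Σ-irrelevant (fV p₁) refl refl) (srcC p₁ rootEdgeGK)))
        htgt : ∀ e → hV (tgt G' e) ≡ tgt Q (hE e)
        htgt (inj₁ e) = tgtC hi e
        htgt (inj₂ (inj₁ e)) = trans (cong-Σ-irrelevant (fV p₁) refl refl) (tgtC p₁ _)
        htgt (inj₂ (inj₂ tt)) = trans (cong-Σ-irrelevant (fV p₁) refl refl) (tgtC p₁ rootEdgeGK)
        hlV : ∀ x → lV G' x ≤L lV Q (hV x)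
        hlV (inj₁ t) = lV≤ hi t
        hlV (inj₂ c) = lV≤ p₁ ((inj₂ c , 𝒞K) , refl)
        hlE : ∀ x → lE G' x ≤L lE Q (hE x)
        hlE (inj₁ e) = lE≤ hi e
        hlE (inj₂ (inj₁ e)) = lE≤ p₁ ((inj₂ (inj₁ e) , 𝒞loopK) , refl)
        hlE (inj₂ (inj₂ tt)) = lE≤ p₁ rootEdgeGK
        h : Hom G' Q
        h = record { fV = hV ; fE = hE ; srcC = hsrc ; tgtC = htgt ; lV≤ = hlV ; lE≤ = hlE }
        hwV : ∀ x → hV (wV x) ≡ fV p₁ x
        hwV ((inj₁ t , b) , pf) = proj₁ hiw ((t , b) , pf)
        hwV ((inj₂ c , b) , pf) = cong-Σ-irrelevant (fV p₁) refl (sym (l'V-𝒞⁻¹ b (sym pf)))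
        hwE : ∀ x → hE (wE x) ≡ fE p₁ x
        hwE ((inj₁ e , b) , pf) = proj₂ hiw ((e , b) , pf)
        hwE ((inj₂ (inj₁ e) , b) , pf) = cong-Σ-irrelevant (fE p₁) refl (sym (l'E-𝒞loop⁻¹ b (sym pf)))
        hwE ((inj₂ (inj₂ tt) , b) , pf) = cong-Σ-irrelevant (fE p₁) refl (sym (l'E-𝒞loop⁻¹ b (sym pf)))
        inL : Hom (g T') G'
        inL = record { fV = inj₁ ; fE = inj₁ ; srcC = λ _ → refl ; tgtC = λ _ → refl
                     ; lV≤ = λ _ → ≤refl ; lE≤ = λ _ → ≤refl }
        uniq : ∀ (h' : Hom G' Q) → h' ∘H w' ≈H p₁ → h' ∘H v' ≈H q₁ → h' ≈H h
        uniq h' (e1V , e1E) (e2V , e2E) = uV , uE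
          where
          hu : h' ∘H inL ≈H hi
          hu = hiu (h' ∘H inL) ((λ k → e1V (fV incl k)) , (λ k → e1E (fE incl k))) (e2V , e2E)
          uV : ∀ x → fV h' x ≡ hV x
          uV (inj₁ t) = proj₁ hu t
          uV (inj₂ c) = e1V ((inj₂ c , 𝒞K) , refl)
          uE : ∀ x → fE h' x ≡ hE x
          uE (inj₁ e) = proj₂ hu e
          uE (inj₂ (inj₁ e)) = e1E ((inj₂ (inj₁ e) , 𝒞loopK) , refl)
          uE (inj₂ (inj₂ tt)) = e1E rootEdgeGK

    lifted : Witness G G'
    lifted = record
      { m = m'
      ; mInjV = λ x y e → I.mInjV x y (inj₁-injective e)
      ; mInjE = λ x y e → I.mInjE x y (inj₁-injective e)
      ; α = α'
      ; αmV = I.αmV ; αmE = I.αmE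
      ; reflV = λ { (inj₁ t) z q → cong inj₁ (I.reflV t z q) ; (inj₂ c) z () }
      ; reflE = λ { (inj₁ e) z q → cong inj₁ (I.reflE e z q) ; (inj₂ (inj₁ e)) z () ; (inj₂ (inj₂ tt)) z () }
      ; w = w' ; v = v' ; po = po' }

module Trees (S : Signature) where
  open Signature S
  open Encoding S

  symbolNode : Sym → TG
  symbolNode f = record { g = single (fsym f) ; rt = tt ; vl = [] }

  -- Isomorphic to termG (termG≅tree), but with the first argument attached last, so that a
  -- step inside the k-th argument is lifted by recursion on k.
  mutual
    tree : Term → TG
    tree (var x) = termG (var x)
    tree (app f ts) = treeArgs (symbolNode f) 0 ts

    treeArgs : TG → ℕ → ∀ {n} → Vec Term n → TG
    treeArgs X i [] = X
    treeArgs X i (t ∷ ts) = attach (treeArgs X (suc i) ts) (pos i) (tree t)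

  module _ (ρ : Rule) (lo : LocatedRule S ρ) where
    open StepWitnesses S ρ lo
    open Enc ρ

    RootInContext : ∀ {G H} (rs : Witness G H) → V G → V H → Set
    RootInContext rs c c' = Σ (fV (Witness.α rs) c ≡ Cv) λ pf → fV (Witness.w rs) ((c , 𝒞K) , pf) ≡ c'

    liftIntoArgs : ∀ X j {n} (ts : Vec Term n) (k : Fin n) t' →
                   (rs : Witness (g (tree (lookup ts k))) (g (tree t'))) →
                   RootTracked rs (rt (tree (lookup ts k))) (rt (tree t')) →
                   Σ (Witness (g (treeArgs X j ts)) (g (treeArgs X j (ts [ k ]≔ t')))) λ lifted →
                     RootInContext lifted (rt (treeArgs X j ts)) (rt (treeArgs X j (ts [ k ]≔ t')))
    liftIntoArgs X j (t ∷ ts) zero t' rs ri = LiftBelow.lifted (treeArgs X (suc j) ts) (tree t) (tree t') (pos j) rs ri , refl , refl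
    liftIntoArgs X j (t ∷ ts) (suc k) t' rs ri with liftIntoArgs X (suc j) ts k t' rs ri
    ... | rs1 , pf0 , e0 = LiftAbove.lifted (treeArgs X (suc j) ts) (treeArgs X (suc j) (ts [ k ]≔ t')) (tree t) (pos j) rs1 pf0 e0 , pf0 , cong inj₁ e0

module TreeIso (S : Signature) where
  open Signature S
  open Encoding S
  open Trees S

  VarAt : ∀ (A C : TG) → ℕ → V (g A) ⊎ V (g C) → Set
  VarAt A C x (inj₁ v) = (x , v) ∈ vl A
  VarAt A C x (inj₂ c) = (x , c) ∈ vl C

  vl-attachˡ : ∀ {A C : TG} {lam x v} → (x , v) ∈ vl A → (x , inj₁ v) ∈ vl (attach A lam C)
  vl-attachˡ {A} {C} m = ∈-++⁺ˡ (∈-map⁺ (Prod.map₂ inj₁) m)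
  vl-attachʳ : ∀ {A C : TG} {lam x c} → (x , c) ∈ vl C → (x , inj₂ c) ∈ vl (attach A lam C)
  vl-attachʳ {A} {C} m = ∈-++⁺ʳ (map (Prod.map₂ inj₁) (vl A)) (∈-map⁺ (Prod.map₂ inj₂) m)
  vl-attach⁻ : ∀ {A C : TG} {lam x z} → (x , z) ∈ vl (attach A lam C) → VarAt A C x z
  vl-attach⁻ {A} {C} m with ∈-++⁻ (map (Prod.map₂ inj₁) (vl A)) m
  ... | inj₁ m1 with ∈-map⁻ (Prod.map₂ inj₁) m1
  ... | (x' , v') , mm , refl = mm
  vl-attach⁻ {A} {C} m | inj₂ m2 with ∈-map⁻ (Prod.map₂ inj₂) m2
  ... | (x' , v') , mm , refl = mm

  record TGIso (A B : TG) : Set where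
    field
      toV : V (g A) → V (g B)
      fromV : V (g B) → V (g A)
      toE : E (g A) → E (g B)
      fromE : E (g B) → E (g A)
      toV-fromV : ∀ v → toV (fromV v) ≡ v
      fromV-toV : ∀ v → fromV (toV v) ≡ v
      toE-fromE : ∀ e → toE (fromE e) ≡ e
      fromE-toE : ∀ e → fromE (toE e) ≡ e
      toV-src : ∀ e → toV (src (g A) e) ≡ src (g B) (toE e)
      toV-tgt : ∀ e → toV (tgt (g A) e) ≡ tgt (g B) (toE e)
      lV-toV : ∀ v → lV (g B) (toV v) ≡ lV (g A) v
      lE-toE : ∀ e → lE (g B) (toE e) ≡ lE (g A) e
      toV-rt : toV (rt A) ≡ rt B
      vl-toV : ∀ {x v} → (x , v) ∈ vl A → (x , toV v) ∈ vl B
      vl-fromV : ∀ {x v} → (x , v) ∈ vl B → (x , fromV v) ∈ vl A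
  open TGIso

  TGIso-refl : ∀ A → TGIso A A
  TGIso-refl A = record
    { toV = λ v → v ; fromV = λ v → v ; toE = λ e → e ; fromE = λ e → e
    ; toV-fromV = λ _ → refl ; fromV-toV = λ _ → refl ; toE-fromE = λ _ → refl ; fromE-toE = λ _ → refl
    ; toV-src = λ _ → refl ; toV-tgt = λ _ → refl ; lV-toV = λ _ → refl ; lE-toE = λ _ → refl ; toV-rt = refl
    ; vl-toV = λ m → m ; vl-fromV = λ m → m }

  TGIso-trans : ∀ {A B C} → TGIso A B → TGIso B C → TGIso A C
  TGIso-trans i j = record
    { toV = λ v → toV j (toV i v) ; fromV = λ v → fromV i (fromV j v)
    ; toE = λ e → toE j (toE i e) ; fromE = λ e → fromE i (fromE j e)
    ; toV-fromV = λ v → trans (cong (toV j) (toV-fromV i _)) (toV-fromV j v)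
    ; fromV-toV = λ v → trans (cong (fromV i) (fromV-toV j _)) (fromV-toV i v)
    ; toE-fromE = λ e → trans (cong (toE j) (toE-fromE i _)) (toE-fromE j e)
    ; fromE-toE = λ e → trans (cong (fromE i) (fromE-toE j _)) (fromE-toE i e)
    ; toV-src = λ e → trans (cong (toV j) (toV-src i e)) (toV-src j _)
    ; toV-tgt = λ e → trans (cong (toV j) (toV-tgt i e)) (toV-tgt j _)
    ; lV-toV = λ v → trans (lV-toV j _) (lV-toV i v)
    ; lE-toE = λ e → trans (lE-toE j _) (lE-toE i e)
    ; toV-rt = trans (cong (toV j) (toV-rt i)) (toV-rt j)
    ; vl-toV = λ m → vl-toV j (vl-toV i m) ; vl-fromV = λ m → vl-fromV i (vl-fromV j m) }

  fromV-src : ∀ {A B} (i : TGIso A B) e → fromV i (src (g B) e) ≡ src (g A) (fromE i e)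
  fromV-src {A} {B} i e = trans (cong (fromV i) (trans (cong (src (g B)) (sym (toE-fromE i e))) (sym (toV-src i _)))) (fromV-toV i _)
  fromV-tgt : ∀ {A B} (i : TGIso A B) e → fromV i (tgt (g B) e) ≡ tgt (g A) (fromE i e)
  fromV-tgt {A} {B} i e = trans (cong (fromV i) (trans (cong (tgt (g B)) (sym (toE-fromE i e))) (sym (toV-tgt i _)))) (fromV-toV i _)
  lV-fromV : ∀ {A B} (i : TGIso A B) v → lV (g A) (fromV i v) ≡ lV (g B) v
  lV-fromV {A} {B} i v = trans (sym (lV-toV i _)) (cong (lV (g B)) (toV-fromV i v))
  lE-fromE : ∀ {A B} (i : TGIso A B) e → lE (g A) (fromE i e) ≡ lE (g B) e
  lE-fromE {A} {B} i e = trans (sym (lE-toE i _)) (cong (lE (g B)) (toE-fromE i e))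

  attach-cong : ∀ {A A' C C'} lam → TGIso A A' → TGIso C C' → TGIso (attach A lam C) (attach A' lam C')
  attach-cong {A} {A'} {C} {C'} lam i j = record
    { toV = FV ; fromV = GV ; toE = FE ; fromE = GE
    ; toV-fromV = λ { (inj₁ v) → cong inj₁ (toV-fromV i v) ; (inj₂ v) → cong inj₂ (toV-fromV j v) }
    ; fromV-toV = λ { (inj₁ v) → cong inj₁ (fromV-toV i v) ; (inj₂ v) → cong inj₂ (fromV-toV j v) }
    ; toE-fromE = λ { (inj₁ e) → cong inj₁ (toE-fromE i e) ; (inj₂ (inj₁ e)) → cong (λ x → inj₂ (inj₁ x)) (toE-fromE j e) ; (inj₂ (inj₂ tt)) → refl }
    ; fromE-toE = λ { (inj₁ e) → cong inj₁ (fromE-toE i e) ; (inj₂ (inj₁ e)) → cong (λ x → inj₂ (inj₁ x)) (fromE-toE j e) ; (inj₂ (inj₂ tt)) → refl }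
    ; toV-src = λ { (inj₁ e) → cong inj₁ (toV-src i e) ; (inj₂ (inj₁ e)) → cong inj₂ (toV-src j e) ; (inj₂ (inj₂ tt)) → cong inj₁ (toV-rt i) }
    ; toV-tgt = λ { (inj₁ e) → cong inj₁ (toV-tgt i e) ; (inj₂ (inj₁ e)) → cong inj₂ (toV-tgt j e) ; (inj₂ (inj₂ tt)) → cong inj₂ (toV-rt j) }
    ; lV-toV = λ { (inj₁ v) → lV-toV i v ; (inj₂ v) → lV-toV j v }
    ; lE-toE = λ { (inj₁ e) → lE-toE i e ; (inj₂ (inj₁ e)) → lE-toE j e ; (inj₂ (inj₂ tt)) → refl }
    ; toV-rt = cong inj₁ (toV-rt i)
    ; vl-toV = λ m → fwd (vl-attach⁻ {A} {C} {lam} m)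
    ; vl-fromV = λ m → bwd (vl-attach⁻ {A'} {C'} {lam} m) }
    where
    FV : V (g A) ⊎ V (g C) → V (g A') ⊎ V (g C')
    FV = Sum.map (toV i) (toV j)
    GV : V (g A') ⊎ V (g C') → V (g A) ⊎ V (g C)
    GV = Sum.map (fromV i) (fromV j)
    FE : E (g A) ⊎ (E (g C) ⊎ ⊤) → E (g A') ⊎ (E (g C') ⊎ ⊤)
    FE = Sum.map (toE i) (Sum.map (toE j) (λ x → x))
    GE : E (g A') ⊎ (E (g C') ⊎ ⊤) → E (g A) ⊎ (E (g C) ⊎ ⊤)
    GE = Sum.map (fromE i) (Sum.map (fromE j) (λ x → x))
    fwd : ∀ {x z} → VarAt A C x z → (x , FV z) ∈ vl (attach A' lam C')
    fwd {z = inj₁ v} m = vl-attachˡ {A'} {C'} {lam} (vl-toV i m)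
    fwd {z = inj₂ c} m = vl-attachʳ {A'} {C'} {lam} (vl-toV j m)
    bwd : ∀ {x z} → VarAt A' C' x z → (x , GV z) ∈ vl (attach A lam C)
    bwd {z = inj₁ v} m = vl-attachˡ {A} {C} {lam} (vl-fromV i m)
    bwd {z = inj₂ c} m = vl-attachʳ {A} {C} {lam} (vl-fromV j m)

  attach-swap : ∀ X l1 A l2 B → TGIso (attach (attach X l1 A) l2 B) (attach (attach X l2 B) l1 A)
  attach-swap X l1 A l2 B = record
    { toV = sw ; fromV = sw
    ; toE = sw ; fromE = sw
    ; toV-fromV = λ { (inj₁ (inj₁ x)) → refl ; (inj₁ (inj₂ x)) → refl ; (inj₂ x) → refl }
    ; fromV-toV = λ { (inj₁ (inj₁ x)) → refl ; (inj₁ (inj₂ x)) → refl ; (inj₂ x) → refl }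
    ; toE-fromE = λ { (inj₁ (inj₁ x)) → refl ; (inj₁ (inj₂ x)) → refl ; (inj₂ x) → refl }
    ; fromE-toE = λ { (inj₁ (inj₁ x)) → refl ; (inj₁ (inj₂ x)) → refl ; (inj₂ x) → refl }
    ; toV-src = λ { (inj₁ (inj₁ x)) → refl ; (inj₁ (inj₂ (inj₁ x))) → refl ; (inj₁ (inj₂ (inj₂ tt))) → refl
               ; (inj₂ (inj₁ x)) → refl ; (inj₂ (inj₂ tt)) → refl }
    ; toV-tgt = λ { (inj₁ (inj₁ x)) → refl ; (inj₁ (inj₂ (inj₁ x))) → refl ; (inj₁ (inj₂ (inj₂ tt))) → refl
               ; (inj₂ (inj₁ x)) → refl ; (inj₂ (inj₂ tt)) → refl }
    ; lV-toV = λ { (inj₁ (inj₁ x)) → refl ; (inj₁ (inj₂ x)) → refl ; (inj₂ x) → refl }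
    ; lE-toE = λ { (inj₁ (inj₁ x)) → refl ; (inj₁ (inj₂ (inj₁ x))) → refl ; (inj₁ (inj₂ (inj₂ tt))) → refl
              ; (inj₂ (inj₁ x)) → refl ; (inj₂ (inj₂ tt)) → refl }
    ; toV-rt = refl
    ; vl-toV = λ m → fwd (vl-attach⁻ {attach X l1 A} {B} {l2} m)
    ; vl-fromV = λ m → bwd (vl-attach⁻ {attach X l2 B} {A} {l1} m) }
    where
    sw : ∀ {P Q R : Set} → (P ⊎ Q) ⊎ R → (P ⊎ R) ⊎ Q
    sw (inj₁ (inj₁ x)) = inj₁ (inj₁ x)
    sw (inj₁ (inj₂ x)) = inj₂ x
    sw (inj₂ x) = inj₁ (inj₂ x)
    fwd : ∀ {x z} → VarAt (attach X l1 A) B x z → (x , sw z) ∈ vl (attach (attach X l2 B) l1 A)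
    fwd {z = inj₁ (inj₁ v)} m = vl-attachˡ {attach X l2 B} {A} {l1} (vl-attachˡ {X} {B} {l2} (vl-attach⁻ {X} {A} {l1} m))
    fwd {z = inj₁ (inj₂ v)} m = vl-attachʳ {attach X l2 B} {A} {l1} (vl-attach⁻ {X} {A} {l1} m)
    fwd {z = inj₂ v} m = vl-attachˡ {attach X l2 B} {A} {l1} (vl-attachʳ {X} {B} {l2} m)
    bwd : ∀ {x z} → VarAt (attach X l2 B) A x z → (x , sw z) ∈ vl (attach (attach X l1 A) l2 B)
    bwd {z = inj₁ (inj₁ v)} m = vl-attachˡ {attach X l1 A} {B} {l2} (vl-attachˡ {X} {A} {l1} (vl-attach⁻ {X} {B} {l2} m))
    bwd {z = inj₁ (inj₂ v)} m = vl-attachʳ {attach X l1 A} {B} {l2} (vl-attach⁻ {X} {B} {l2} m)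
    bwd {z = inj₂ v} m = vl-attachˡ {attach X l1 A} {B} {l2} (vl-attachʳ {X} {A} {l1} m)

  treeArgs-attach : ∀ X lam C j {n} (ts : Vec Term n) → TGIso (treeArgs (attach X lam C) j ts) (attach (treeArgs X j ts) lam C)
  treeArgs-attach X lam C j [] = TGIso-refl _
  treeArgs-attach X lam C j (t ∷ ts) = TGIso-trans (attach-cong (pos j) (treeArgs-attach X lam C (suc j) ts) (TGIso-refl (tree t))) (attach-swap (treeArgs X (suc j) ts) lam C (pos j) (tree t))

  mutual
    termG≅tree : ∀ t → TGIso (termG t) (tree t)
    termG≅tree (var x) = TGIso-refl _
    termG≅tree (app f ts) = attachAll≅treeArgs (symbolNode f) 0 ts
    attachAll≅treeArgs : ∀ T i {n} (ts : Vec Term n) → TGIso (attachAll T i ts) (treeArgs T i ts)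
    attachAll≅treeArgs T i [] = TGIso-refl T
    attachAll≅treeArgs T i (t ∷ ts) = TGIso-trans (attachAll≅treeArgs (attach T (pos i) (termG t)) (suc i) ts)
      (TGIso-trans (treeArgs-attach T (pos i) (termG t) (suc i) ts) (attach-cong (pos i) (TGIso-refl _) (termG≅tree t)))

  mutual
    Leaf : Term → Set
    Leaf (var x) = ⊤
    Leaf (app f ts) = Leafᵃ ts
    Leafᵃ : ∀ {n} → Vec Term n → Set
    Leafᵃ [] = ⊥
    Leafᵃ (t ∷ ts) = Leafᵃ ts ⊎ Leaf t

  mutual
    leafVar : ∀ t → Leaf t → ℕ
    leafVar (var x) tt = x
    leafVar (app f ts) p = leafVarᵃ ts p
    leafVarᵃ : ∀ {n} (ts : Vec Term n) → Leafᵃ ts → ℕ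
    leafVarᵃ (t ∷ ts) (inj₁ p) = leafVarᵃ ts p
    leafVarᵃ (t ∷ ts) (inj₂ p) = leafVar t p

  mutual
    leafV : ∀ t → Leaf t → V (g (tree t))
    leafV (var x) tt = tt
    leafV (app f ts) p = leafVᵃ f 0 ts p
    leafVᵃ : ∀ f i {n} (ts : Vec Term n) → Leafᵃ ts → V (g (treeArgs (symbolNode f) i ts))
    leafVᵃ f i (t ∷ ts) (inj₁ p) = inj₁ (leafVᵃ f (suc i) ts p)
    leafVᵃ f i (t ∷ ts) (inj₂ p) = inj₂ (leafV t p)

  mutual
    leafV-injective : ∀ t p p' → leafV t p ≡ leafV t p' → p ≡ p'
    leafV-injective (var x) tt tt e = refl
    leafV-injective (app f ts) p p' e = leafVᵃ-injective f 0 ts p p' e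
    leafVᵃ-injective : ∀ f i {n} (ts : Vec Term n) p p' → leafVᵃ f i ts p ≡ leafVᵃ f i ts p' → p ≡ p'
    leafVᵃ-injective f i (t ∷ ts) (inj₁ p) (inj₁ p') e = cong inj₁ (leafVᵃ-injective f (suc i) ts p p' (inj₁-injective e))
    leafVᵃ-injective f i (t ∷ ts) (inj₁ p) (inj₂ p') ()
    leafVᵃ-injective f i (t ∷ ts) (inj₂ p) (inj₁ p') ()
    leafVᵃ-injective f i (t ∷ ts) (inj₂ p) (inj₂ p') e = cong inj₂ (leafV-injective t p p' (inj₂-injective e))

  mutual
    vl-leafV⁺ : ∀ t p → (leafVar t p , leafV t p) ∈ vl (tree t)
    vl-leafV⁺ (var x) tt = here refl
    vl-leafV⁺ (app f ts) p = vl-leafVᵃ⁺ f 0 ts p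
    vl-leafVᵃ⁺ : ∀ f i {n} (ts : Vec Term n) p → (leafVarᵃ ts p , leafVᵃ f i ts p) ∈ vl (treeArgs (symbolNode f) i ts)
    vl-leafVᵃ⁺ f i (t ∷ ts) (inj₁ p) = vl-attachˡ {treeArgs (symbolNode f) (suc i) ts} {tree t} {pos i} (vl-leafVᵃ⁺ f (suc i) ts p)
    vl-leafVᵃ⁺ f i (t ∷ ts) (inj₂ p) = vl-attachʳ {treeArgs (symbolNode f) (suc i) ts} {tree t} {pos i} (vl-leafV⁺ t p)

  mutual
    vl-leafV⁻ : ∀ t {x v} → (x , v) ∈ vl (tree t) → Σ (Leaf t) λ p → (v ≡ leafV t p) × (x ≡ leafVar t p)
    vl-leafV⁻ (var x) (here refl) = tt , refl , refl
    vl-leafV⁻ (var x) (there ())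
    vl-leafV⁻ (app f ts) m = vl-leafVᵃ⁻ f 0 ts m
    vl-leafVᵃ⁻ : ∀ f i {n} (ts : Vec Term n) {x v} → (x , v) ∈ vl (treeArgs (symbolNode f) i ts) →
           Σ (Leafᵃ ts) λ p → (v ≡ leafVᵃ f i ts p) × (x ≡ leafVarᵃ ts p)
    vl-leafVᵃ⁻ f i [] ()
    vl-leafVᵃ⁻ f i (t ∷ ts) {x} {v} m = go v (vl-attach⁻ {treeArgs (symbolNode f) (suc i) ts} {tree t} {pos i} m)
      where
      go : ∀ z → VarAt (treeArgs (symbolNode f) (suc i) ts) (tree t) x z → Σ (Leafᵃ (t ∷ ts)) λ p → (z ≡ leafVᵃ f i (t ∷ ts) p) × (x ≡ leafVarᵃ (t ∷ ts) p)
      go (inj₁ a) mm with vl-leafVᵃ⁻ f (suc i) ts mm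
      ... | p , e1 , e2 = inj₁ p , cong inj₁ e1 , e2
      go (inj₂ c) mm with vl-leafV⁻ t mm
      ... | p , e1 , e2 = inj₂ p , cong inj₂ e1 , e2

module Instantiation (S : Signature) (σ : ℕ → TRSDefs.Term S) where
  open Signature S
  open Encoding S
  open Trees S
  open TreeIso S

  -- A vertex of tree (t σ) is either the image under patV of a non-leaf vertex of tree t, or lies
  -- in the copy (instV) of tree (σ x) that replaces a variable leaf x of t; splitV computes this
  -- decomposition and joinV inverts it.
  VP : Term → Set
  VP t = V (g (tree t))
  EP : Term → Set
  EP t = E (g (tree t))
  VA : Sym → ℕ → ∀ {n} → Vec Term n → Set
  VA f i ts = V (g (treeArgs (symbolNode f) i ts))
  EA : Sym → ℕ → ∀ {n} → Vec Term n → Set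
  EA f i ts = E (g (treeArgs (symbolNode f) i ts))

  Region : ∀ t → Set
  Region t = Σ (Leaf t) λ p → VP (σ (leafVar t p))
  RegionE : ∀ t → Set
  RegionE t = Σ (Leaf t) λ p → EP (σ (leafVar t p))
  Regionᵃ : ∀ {n} → Vec Term n → Set
  Regionᵃ ts = Σ (Leafᵃ ts) λ p → VP (σ (leafVarᵃ ts p))
  RegionEᵃ : ∀ {n} → Vec Term n → Set
  RegionEᵃ ts = Σ (Leafᵃ ts) λ p → EP (σ (leafVarᵃ ts p))

  mutual
    patV : ∀ t → VP t → VP (t [ σ ]ₛ)
    patV (var x) tt = rt (tree (σ x))
    patV (app f ts) a = patVᵃ f 0 ts a
    patVᵃ : ∀ f i {n} (ts : Vec Term n) → VA f i ts → VA f i (ts [ σ ]ₛᵥ)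
    patVᵃ f i [] a = a
    patVᵃ f i (t ∷ ts) (inj₁ a) = inj₁ (patVᵃ f (suc i) ts a)
    patVᵃ f i (t ∷ ts) (inj₂ c) = inj₂ (patV t c)

  mutual
    patE : ∀ t → EP t → EP (t [ σ ]ₛ)
    patE (var x) ()
    patE (app f ts) a = patEᵃ f 0 ts a
    patEᵃ : ∀ f i {n} (ts : Vec Term n) → EA f i ts → EA f i (ts [ σ ]ₛᵥ)
    patEᵃ f i [] ()
    patEᵃ f i (t ∷ ts) (inj₁ a) = inj₁ (patEᵃ f (suc i) ts a)
    patEᵃ f i (t ∷ ts) (inj₂ (inj₁ e)) = inj₂ (inj₁ (patE t e))
    patEᵃ f i (t ∷ ts) (inj₂ (inj₂ tt)) = inj₂ (inj₂ tt)

  mutual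
    instV : ∀ t (p : Leaf t) → VP (σ (leafVar t p)) → VP (t [ σ ]ₛ)
    instV (var x) tt c = c
    instV (app f ts) p c = instVᵃ f 0 ts p c
    instVᵃ : ∀ f i {n} (ts : Vec Term n) (p : Leafᵃ ts) → VP (σ (leafVarᵃ ts p)) → VA f i (ts [ σ ]ₛᵥ)
    instVᵃ f i (t ∷ ts) (inj₁ p) c = inj₁ (instVᵃ f (suc i) ts p c)
    instVᵃ f i (t ∷ ts) (inj₂ p) c = inj₂ (instV t p c)

  mutual
    instE : ∀ t (p : Leaf t) → EP (σ (leafVar t p)) → EP (t [ σ ]ₛ)
    instE (var x) tt c = c
    instE (app f ts) p c = instEᵃ f 0 ts p c
    instEᵃ : ∀ f i {n} (ts : Vec Term n) (p : Leafᵃ ts) → EP (σ (leafVarᵃ ts p)) → EA f i (ts [ σ ]ₛᵥ)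
    instEᵃ f i (t ∷ ts) (inj₁ p) c = inj₁ (instEᵃ f (suc i) ts p c)
    instEᵃ f i (t ∷ ts) (inj₂ p) c = inj₂ (inj₁ (instE t p c))

  mutual
    splitV : ∀ t → VP (t [ σ ]ₛ) → VP t ⊎ Region t
    splitV (var x) c = inj₂ (tt , c)
    splitV (app f ts) a = splitVᵃ f 0 ts a
    splitVᵃ : ∀ f i {n} (ts : Vec Term n) → VA f i (ts [ σ ]ₛᵥ) → VA f i ts ⊎ Regionᵃ ts
    splitVᵃ f i [] a = inj₁ a
    splitVᵃ f i (t ∷ ts) (inj₁ a) = Sum.map inj₁ (λ pc → inj₁ (proj₁ pc) , proj₂ pc) (splitVᵃ f (suc i) ts a)
    splitVᵃ f i (t ∷ ts) (inj₂ c) = Sum.map inj₂ (λ pc → inj₂ (proj₁ pc) , proj₂ pc) (splitV t c)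

  mutual
    splitE : ∀ t → EP (t [ σ ]ₛ) → EP t ⊎ RegionE t
    splitE (var x) c = inj₂ (tt , c)
    splitE (app f ts) a = splitEᵃ f 0 ts a
    splitEᵃ : ∀ f i {n} (ts : Vec Term n) → EA f i (ts [ σ ]ₛᵥ) → EA f i ts ⊎ RegionEᵃ ts
    splitEᵃ f i [] a = inj₁ a
    splitEᵃ f i (t ∷ ts) (inj₁ a) = Sum.map inj₁ (λ pc → inj₁ (proj₁ pc) , proj₂ pc) (splitEᵃ f (suc i) ts a)
    splitEᵃ f i (t ∷ ts) (inj₂ (inj₁ c)) = Sum.map (λ e → inj₂ (inj₁ e)) (λ pc → inj₂ (proj₁ pc) , proj₂ pc) (splitE t c)
    splitEᵃ f i (t ∷ ts) (inj₂ (inj₂ tt)) = inj₁ (inj₂ (inj₂ tt))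

  joinV : ∀ t → VP t ⊎ Region t → VP (t [ σ ]ₛ)
  joinV t (inj₁ y) = patV t y
  joinV t (inj₂ (p , c)) = instV t p c
  joinE : ∀ t → EP t ⊎ RegionE t → EP (t [ σ ]ₛ)
  joinE t (inj₁ y) = patE t y
  joinE t (inj₂ (p , c)) = instE t p c

  mutual
    leafAt : ∀ t → VP t → Maybe (Leaf t)
    leafAt (var x) tt = just tt
    leafAt (app f ts) a = leafAtᵃ f 0 ts a
    leafAtᵃ : ∀ f i {n} (ts : Vec Term n) → VA f i ts → Maybe (Leafᵃ ts)
    leafAtᵃ f i [] a = nothing
    leafAtᵃ f i (t ∷ ts) (inj₁ a) = May.map inj₁ (leafAtᵃ f (suc i) ts a)
    leafAtᵃ f i (t ∷ ts) (inj₂ c) = May.map inj₂ (leafAt t c)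

  mutual
    isRoot : ∀ s → VP s → Bool
    isRoot (var x) tt = true
    isRoot (app f ts) a = isRootᵃ f 0 ts a
    isRootᵃ : ∀ f i {n} (ts : Vec Term n) → VA f i ts → Bool
    isRootᵃ f i [] a = true
    isRootᵃ f i (t ∷ ts) (inj₁ a) = isRootᵃ f (suc i) ts a
    isRootᵃ f i (t ∷ ts) (inj₂ c) = false

  joinVᵃ : ∀ f i {n} (ts : Vec Term n) → VA f i ts ⊎ Regionᵃ ts → VA f i (ts [ σ ]ₛᵥ)
  joinVᵃ f i ts (inj₁ y) = patVᵃ f i ts y
  joinVᵃ f i ts (inj₂ (p , c)) = instVᵃ f i ts p c
  joinEᵃ : ∀ f i {n} (ts : Vec Term n) → EA f i ts ⊎ RegionEᵃ ts → EA f i (ts [ σ ]ₛᵥ)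
  joinEᵃ f i ts (inj₁ y) = patEᵃ f i ts y
  joinEᵃ f i ts (inj₂ (p , c)) = instEᵃ f i ts p c

  joinV-app : ∀ f (ts : Vec Term (ar f)) x → joinV (app f ts) x ≡ joinVᵃ f 0 ts x
  joinV-app f ts (inj₁ y) = refl
  joinV-app f ts (inj₂ (p , c)) = refl
  joinE-app : ∀ f (ts : Vec Term (ar f)) x → joinE (app f ts) x ≡ joinEᵃ f 0 ts x
  joinE-app f ts (inj₁ y) = refl
  joinE-app f ts (inj₂ (p , c)) = refl

  mutual
    joinV-splitV : ∀ t a → joinV t (splitV t a) ≡ a
    joinV-splitV (var x) c = refl
    joinV-splitV (app f ts) a = trans (joinV-app f ts (splitVᵃ f 0 ts a)) (joinVᵃ-splitVᵃ f 0 ts a)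
    joinVᵃ-splitVᵃ : ∀ f i {n} (ts : Vec Term n) a → joinVᵃ f i ts (splitVᵃ f i ts a) ≡ a
    joinVᵃ-splitVᵃ f i [] a = refl
    joinVᵃ-splitVᵃ f i (t ∷ ts) (inj₁ a) with splitVᵃ f (suc i) ts a | joinVᵃ-splitVᵃ f (suc i) ts a
    ... | inj₁ y | e = cong inj₁ e
    ... | inj₂ (p , c) | e = cong inj₁ e
    joinVᵃ-splitVᵃ f i (t ∷ ts) (inj₂ c) with splitV t c | joinV-splitV t c
    ... | inj₁ y | e = cong inj₂ e
    ... | inj₂ (p , c') | e = cong inj₂ e

  mutual
    joinE-splitE : ∀ t a → joinE t (splitE t a) ≡ a
    joinE-splitE (var x) c = refl
    joinE-splitE (app f ts) a = trans (joinE-app f ts (splitEᵃ f 0 ts a)) (joinEᵃ-splitEᵃ f 0 ts a)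
    joinEᵃ-splitEᵃ : ∀ f i {n} (ts : Vec Term n) a → joinEᵃ f i ts (splitEᵃ f i ts a) ≡ a
    joinEᵃ-splitEᵃ f i [] a = refl
    joinEᵃ-splitEᵃ f i (t ∷ ts) (inj₁ a) with splitEᵃ f (suc i) ts a | joinEᵃ-splitEᵃ f (suc i) ts a
    ... | inj₁ y | e = cong inj₁ e
    ... | inj₂ (p , c) | e = cong inj₁ e
    joinEᵃ-splitEᵃ f i (t ∷ ts) (inj₂ (inj₁ c)) with splitE t c | joinE-splitE t c
    ... | inj₁ y | e = cong (λ z → inj₂ (inj₁ z)) e
    ... | inj₂ (p , c') | e = cong (λ z → inj₂ (inj₁ z)) e
    joinEᵃ-splitEᵃ f i (t ∷ ts) (inj₂ (inj₂ tt)) = refl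

  mutual
    splitV-instV : ∀ t p c → splitV t (instV t p c) ≡ inj₂ (p , c)
    splitV-instV (var x) tt c = refl
    splitV-instV (app f ts) p c = splitVᵃ-instVᵃ f 0 ts p c
    splitVᵃ-instVᵃ : ∀ f i {n} (ts : Vec Term n) p c → splitVᵃ f i ts (instVᵃ f i ts p c) ≡ inj₂ (p , c)
    splitVᵃ-instVᵃ f i (t ∷ ts) (inj₁ p) c rewrite splitVᵃ-instVᵃ f (suc i) ts p c = refl
    splitVᵃ-instVᵃ f i (t ∷ ts) (inj₂ p) c rewrite splitV-instV t p c = refl

  mutual
    splitE-instE : ∀ t p c → splitE t (instE t p c) ≡ inj₂ (p , c)
    splitE-instE (var x) tt c = refl
    splitE-instE (app f ts) p c = splitEᵃ-instEᵃ f 0 ts p c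
    splitEᵃ-instEᵃ : ∀ f i {n} (ts : Vec Term n) p c → splitEᵃ f i ts (instEᵃ f i ts p c) ≡ inj₂ (p , c)
    splitEᵃ-instEᵃ f i (t ∷ ts) (inj₁ p) c rewrite splitEᵃ-instEᵃ f (suc i) ts p c = refl
    splitEᵃ-instEᵃ f i (t ∷ ts) (inj₂ p) c rewrite splitE-instE t p c = refl

  mutual
    splitE-patE : ∀ t y → splitE t (patE t y) ≡ inj₁ y
    splitE-patE (var x) ()
    splitE-patE (app f ts) y = splitEᵃ-patEᵃ f 0 ts y
    splitEᵃ-patEᵃ : ∀ f i {n} (ts : Vec Term n) y → splitEᵃ f i ts (patEᵃ f i ts y) ≡ inj₁ y
    splitEᵃ-patEᵃ f i [] ()
    splitEᵃ-patEᵃ f i (t ∷ ts) (inj₁ a) rewrite splitEᵃ-patEᵃ f (suc i) ts a = refl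
    splitEᵃ-patEᵃ f i (t ∷ ts) (inj₂ (inj₁ e)) rewrite splitE-patE t e = refl
    splitEᵃ-patEᵃ f i (t ∷ ts) (inj₂ (inj₂ tt)) = refl

  regionRoot : ∀ t (p : Leaf t) → VP (σ (leafVar t p))
  regionRoot t p = rt (tree (σ (leafVar t p)))

  splitPat : ∀ t → VP t → Maybe (Leaf t) → VP t ⊎ Region t
  splitPat t y (just p) = inj₂ (p , regionRoot t p)
  splitPat t y nothing = inj₁ y

  splitPatᵃ : ∀ f i {n} (ts : Vec Term n) → VA f i ts → Maybe (Leafᵃ ts) → VA f i ts ⊎ Regionᵃ ts
  splitPatᵃ f i ts y (just p) = inj₂ (p , rt (tree (σ (leafVarᵃ ts p))))
  splitPatᵃ f i ts y nothing = inj₁ y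

  splitPat-app : ∀ f (ts : Vec Term (ar f)) y m → splitPatᵃ f 0 ts y m ≡ splitPat (app f ts) y m
  splitPat-app f ts y (just p) = refl
  splitPat-app f ts y nothing = refl

  mutual
    splitV-patV : ∀ t y → splitV t (patV t y) ≡ splitPat t y (leafAt t y)
    splitV-patV (var x) tt = refl
    splitV-patV (app f ts) y = trans (splitVᵃ-patVᵃ f 0 ts y) (splitPat-app f ts y _)
    splitVᵃ-patVᵃ : ∀ f i {n} (ts : Vec Term n) y → splitVᵃ f i ts (patVᵃ f i ts y) ≡ splitPatᵃ f i ts y (leafAtᵃ f i ts y)
    splitVᵃ-patVᵃ f i [] y = refl
    splitVᵃ-patVᵃ f i (t ∷ ts) (inj₁ a) rewrite splitVᵃ-patVᵃ f (suc i) ts a with leafAtᵃ f (suc i) ts a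
    ... | just p = refl
    ... | nothing = refl
    splitVᵃ-patVᵃ f i (t ∷ ts) (inj₂ c) rewrite splitV-patV t c with leafAt t c
    ... | just p = refl
    ... | nothing = refl

  mutual
    leafAt-just : ∀ t y p → leafAt t y ≡ just p → y ≡ leafV t p
    leafAt-just (var x) tt tt e = refl
    leafAt-just (app f ts) y p e = leafAtᵃ-just f 0 ts y p e
    leafAtᵃ-just : ∀ f i {n} (ts : Vec Term n) y p → leafAtᵃ f i ts y ≡ just p → y ≡ leafVᵃ f i ts p
    leafAtᵃ-just f i [] y p ()
    leafAtᵃ-just f i (t ∷ ts) (inj₁ a) p e with leafAtᵃ f (suc i) ts a | leafAtᵃ-just f (suc i) ts a
    leafAtᵃ-just f i (t ∷ ts) (inj₁ a) (inj₁ p) refl | just q | h = cong inj₁ (h q refl)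
    leafAtᵃ-just f i (t ∷ ts) (inj₁ a) p () | nothing | h
    leafAtᵃ-just f i (t ∷ ts) (inj₂ c) p' e' with leafAt t c | leafAt-just t c
    leafAtᵃ-just f i (t ∷ ts) (inj₂ c) (inj₂ p) refl | just q | h = cong inj₂ (h q refl)
    leafAtᵃ-just f i (t ∷ ts) (inj₂ c) p () | nothing | h

  mutual
    patV-root : ∀ t → patV t (rt (tree t)) ≡ rt (tree (t [ σ ]ₛ))
    patV-root (var x) = refl
    patV-root (app f ts) = patVᵃ-root f 0 ts
    patVᵃ-root : ∀ f i {n} (ts : Vec Term n) → patVᵃ f i ts (rt (treeArgs (symbolNode f) i ts)) ≡ rt (treeArgs (symbolNode f) i (ts [ σ ]ₛᵥ))
    patVᵃ-root f i [] = refl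
    patVᵃ-root f i (t ∷ ts) = cong inj₁ (patVᵃ-root f (suc i) ts)

  mutual
    instV-root : ∀ t p → instV t p (regionRoot t p) ≡ patV t (leafV t p)
    instV-root (var x) tt = refl
    instV-root (app f ts) p = instVᵃ-root f 0 ts p
    instVᵃ-root : ∀ f i {n} (ts : Vec Term n) p → instVᵃ f i ts p (rt (tree (σ (leafVarᵃ ts p)))) ≡ patVᵃ f i ts (leafVᵃ f i ts p)
    instVᵃ-root f i (t ∷ ts) (inj₁ p) = cong inj₁ (instVᵃ-root f (suc i) ts p)
    instVᵃ-root f i (t ∷ ts) (inj₂ p) = cong inj₂ (instV-root t p)

  mutual
    patV-src : ∀ t e → patV t (src (g (tree t)) e) ≡ src (g (tree (t [ σ ]ₛ))) (patE t e)
    patV-src (var x) ()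
    patV-src (app f ts) e = patVᵃ-src f 0 ts e
    patVᵃ-src : ∀ f i {n} (ts : Vec Term n) e → patVᵃ f i ts (src (g (treeArgs (symbolNode f) i ts)) e) ≡ src (g (treeArgs (symbolNode f) i (ts [ σ ]ₛᵥ))) (patEᵃ f i ts e)
    patVᵃ-src f i [] ()
    patVᵃ-src f i (t ∷ ts) (inj₁ a) = cong inj₁ (patVᵃ-src f (suc i) ts a)
    patVᵃ-src f i (t ∷ ts) (inj₂ (inj₁ e)) = cong inj₂ (patV-src t e)
    patVᵃ-src f i (t ∷ ts) (inj₂ (inj₂ tt)) = cong inj₁ (patVᵃ-root f (suc i) ts)

  mutual
    patV-tgt : ∀ t e → patV t (tgt (g (tree t)) e) ≡ tgt (g (tree (t [ σ ]ₛ))) (patE t e)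
    patV-tgt (var x) ()
    patV-tgt (app f ts) e = patVᵃ-tgt f 0 ts e
    patVᵃ-tgt : ∀ f i {n} (ts : Vec Term n) e → patVᵃ f i ts (tgt (g (treeArgs (symbolNode f) i ts)) e) ≡ tgt (g (treeArgs (symbolNode f) i (ts [ σ ]ₛᵥ))) (patEᵃ f i ts e)
    patVᵃ-tgt f i [] ()
    patVᵃ-tgt f i (t ∷ ts) (inj₁ a) = cong inj₁ (patVᵃ-tgt f (suc i) ts a)
    patVᵃ-tgt f i (t ∷ ts) (inj₂ (inj₁ e)) = cong inj₂ (patV-tgt t e)
    patVᵃ-tgt f i (t ∷ ts) (inj₂ (inj₂ tt)) = cong inj₂ (patV-root t)

  mutual
    instV-src : ∀ t p e → instV t p (src (g (tree (σ (leafVar t p)))) e) ≡ src (g (tree (t [ σ ]ₛ))) (instE t p e)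
    instV-src (var x) tt e = refl
    instV-src (app f ts) p e = instVᵃ-src f 0 ts p e
    instVᵃ-src : ∀ f i {n} (ts : Vec Term n) p e → instVᵃ f i ts p (src (g (tree (σ (leafVarᵃ ts p)))) e) ≡ src (g (treeArgs (symbolNode f) i (ts [ σ ]ₛᵥ))) (instEᵃ f i ts p e)
    instVᵃ-src f i (t ∷ ts) (inj₁ p) e = cong inj₁ (instVᵃ-src f (suc i) ts p e)
    instVᵃ-src f i (t ∷ ts) (inj₂ p) e = cong inj₂ (instV-src t p e)

  mutual
    instV-tgt : ∀ t p e → instV t p (tgt (g (tree (σ (leafVar t p)))) e) ≡ tgt (g (tree (t [ σ ]ₛ))) (instE t p e)
    instV-tgt (var x) tt e = refl
    instV-tgt (app f ts) p e = instVᵃ-tgt f 0 ts p e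
    instVᵃ-tgt : ∀ f i {n} (ts : Vec Term n) p e → instVᵃ f i ts p (tgt (g (tree (σ (leafVarᵃ ts p)))) e) ≡ tgt (g (treeArgs (symbolNode f) i (ts [ σ ]ₛᵥ))) (instEᵃ f i ts p e)
    instVᵃ-tgt f i (t ∷ ts) (inj₁ p) e = cong inj₁ (instVᵃ-tgt f (suc i) ts p e)
    instVᵃ-tgt f i (t ∷ ts) (inj₂ p) e = cong inj₂ (instV-tgt t p e)

  mutual
    lV-instV : ∀ t p c → lV (g (tree (t [ σ ]ₛ))) (instV t p c) ≡ lV (g (tree (σ (leafVar t p)))) c
    lV-instV (var x) tt c = refl
    lV-instV (app f ts) p c = lV-instVᵃ f 0 ts p c
    lV-instVᵃ : ∀ f i {n} (ts : Vec Term n) p c → lV (g (treeArgs (symbolNode f) i (ts [ σ ]ₛᵥ))) (instVᵃ f i ts p c) ≡ lV (g (tree (σ (leafVarᵃ ts p)))) c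
    lV-instVᵃ f i (t ∷ ts) (inj₁ p) c = lV-instVᵃ f (suc i) ts p c
    lV-instVᵃ f i (t ∷ ts) (inj₂ p) c = lV-instV t p c

  mutual
    lE-instE : ∀ t p c → lE (g (tree (t [ σ ]ₛ))) (instE t p c) ≡ lE (g (tree (σ (leafVar t p)))) c
    lE-instE (var x) tt c = refl
    lE-instE (app f ts) p c = lE-instEᵃ f 0 ts p c
    lE-instEᵃ : ∀ f i {n} (ts : Vec Term n) p c → lE (g (treeArgs (symbolNode f) i (ts [ σ ]ₛᵥ))) (instEᵃ f i ts p c) ≡ lE (g (tree (σ (leafVarᵃ ts p)))) c
    lE-instEᵃ f i (t ∷ ts) (inj₁ p) c = lE-instEᵃ f (suc i) ts p c
    lE-instEᵃ f i (t ∷ ts) (inj₂ p) c = lE-instE t p c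

  mutual
    lE-patE : ∀ t y → lE (g (tree (t [ σ ]ₛ))) (patE t y) ≡ lE (g (tree t)) y
    lE-patE (var x) ()
    lE-patE (app f ts) y = lE-patEᵃ f 0 ts y
    lE-patEᵃ : ∀ f i {n} (ts : Vec Term n) y → lE (g (treeArgs (symbolNode f) i (ts [ σ ]ₛᵥ))) (patEᵃ f i ts y) ≡ lE (g (treeArgs (symbolNode f) i ts)) y
    lE-patEᵃ f i [] ()
    lE-patEᵃ f i (t ∷ ts) (inj₁ a) = lE-patEᵃ f (suc i) ts a
    lE-patEᵃ f i (t ∷ ts) (inj₂ (inj₁ e)) = lE-patE t e
    lE-patEᵃ f i (t ∷ ts) (inj₂ (inj₂ tt)) = refl

  mutual
    lV-patV : ∀ t y → leafAt t y ≡ nothing → lV (g (tree (t [ σ ]ₛ))) (patV t y) ≡ lV (g (tree t)) y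
    lV-patV (var x) tt ()
    lV-patV (app f ts) y e = lV-patVᵃ f 0 ts y e
    lV-patVᵃ : ∀ f i {n} (ts : Vec Term n) y → leafAtᵃ f i ts y ≡ nothing → lV (g (treeArgs (symbolNode f) i (ts [ σ ]ₛᵥ))) (patVᵃ f i ts y) ≡ lV (g (treeArgs (symbolNode f) i ts)) y
    lV-patVᵃ f i [] y e = refl
    lV-patVᵃ f i (t ∷ ts) (inj₁ a) e with leafAtᵃ f (suc i) ts a | lV-patVᵃ f (suc i) ts a
    ... | nothing | h = h refl
    lV-patVᵃ f i (t ∷ ts) (inj₁ a) () | just _ | h
    lV-patVᵃ f i (t ∷ ts) (inj₂ c) e with leafAt t c | lV-patV t c
    ... | nothing | h = h refl
    lV-patVᵃ f i (t ∷ ts) (inj₂ c) () | just _ | h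

  mutual
    isRoot-root : ∀ s → isRoot s (rt (tree s)) ≡ true
    isRoot-root (var x) = refl
    isRoot-root (app f ts) = isRootᵃ-root f 0 ts
    isRootᵃ-root : ∀ f i {n} (ts : Vec Term n) → isRootᵃ f i ts (rt (treeArgs (symbolNode f) i ts)) ≡ true
    isRootᵃ-root f i [] = refl
    isRootᵃ-root f i (t ∷ ts) = isRootᵃ-root f (suc i) ts

  mutual
    isRoot⇒≡root : ∀ s c → isRoot s c ≡ true → c ≡ rt (tree s)
    isRoot⇒≡root (var x) tt e = refl
    isRoot⇒≡root (app f ts) c e = isRootᵃ⇒≡root f 0 ts c e
    isRootᵃ⇒≡root : ∀ f i {n} (ts : Vec Term n) c → isRootᵃ f i ts c ≡ true → c ≡ rt (treeArgs (symbolNode f) i ts)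
    isRootᵃ⇒≡root f i [] tt e = refl
    isRootᵃ⇒≡root f i (t ∷ ts) (inj₁ a) e = cong inj₁ (isRootᵃ⇒≡root f (suc i) ts a e)
    isRootᵃ⇒≡root f i (t ∷ ts) (inj₂ c) ()

  mutual
    isRoot-tgt : ∀ s e → isRoot s (tgt (g (tree s)) e) ≡ false
    isRoot-tgt (var x) ()
    isRoot-tgt (app f ts) e = isRootᵃ-tgt f 0 ts e
    isRootᵃ-tgt : ∀ f i {n} (ts : Vec Term n) e → isRootᵃ f i ts (tgt (g (treeArgs (symbolNode f) i ts)) e) ≡ false
    isRootᵃ-tgt f i [] ()
    isRootᵃ-tgt f i (t ∷ ts) (inj₁ a) = isRootᵃ-tgt f (suc i) ts a
    isRootᵃ-tgt f i (t ∷ ts) (inj₂ (inj₁ e)) = refl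
    isRootᵃ-tgt f i (t ∷ ts) (inj₂ (inj₂ tt)) = refl

module VarLists (S : Signature) where
  open Signature S
  open Encoding S

  mutual
    vars-termG : ∀ t → map proj₁ (vl (termG t)) ≡ vars t
    vars-termG (var x) = refl
    vars-termG (app f ts) = vars-attachAll (record { g = single (fsym f) ; rt = tt ; vl = [] }) 0 ts
    vars-attachAll : ∀ T i {n} (ts : Vec Term n) → map proj₁ (vl (attachAll T i ts)) ≡ map proj₁ (vl T) ++ varsV ts
    vars-attachAll T i [] = sym (++-identityʳ _)
    vars-attachAll T i (t ∷ ts) =
      trans (vars-attachAll (attach T (pos i) (termG t)) (suc i) ts)
        (trans (cong (_++ varsV ts) (trans (map-++ proj₁ (map (Prod.map₂ inj₁) (vl T)) (map (Prod.map₂ inj₂) (vl (termG t))))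
                   (cong₂ _++_ (sym (map-∘ {g = proj₁} {f = Prod.map₂ inj₁} (vl T))) (trans (sym (map-∘ {g = proj₁} {f = Prod.map₂ inj₂} (vl (termG t)))) (vars-termG t)))))
               (++-assoc (map proj₁ (vl T)) (vars t) (varsV ts)))

  find-sound : ∀ {A : Set} (xs : List (ℕ × A)) x φ → find xs x ≡ just φ → proj₁ (List.lookup xs φ) ≡ x
  find-sound [] x φ ()
  find-sound ((y , a) ∷ xs) x φ e with y ℕP.≟ x
  find-sound ((y , a) ∷ xs) x zero refl | yes p = p
  find-sound ((y , a) ∷ xs) x φ e | no _ with find xs x | find-sound xs x
  find-sound ((y , a) ∷ xs) x (suc φ) refl | no _ | just k | h = h k refl
  find-sound ((y , a) ∷ xs) x φ () | no _ | nothing | h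

  find-complete : ∀ {A : Set} (xs : List (ℕ × A)) x → x ∈ map proj₁ xs → Σ (Fin (length xs)) λ φ → find xs x ≡ just φ
  find-complete ((y , a) ∷ xs) x m with y ℕP.≟ x
  ... | yes _ = zero , refl
  find-complete ((y , a) ∷ xs) x (here e) | no ne = ⊥-elim (ne (sym e))
  find-complete ((y , a) ∷ xs) x (there m) | no ne with find-complete xs x m
  ... | φ , e = suc φ , cong (May.map suc) e

  located : (ρ : Rule) → LocatedRule S ρ
  located ρ j = find-complete (vl Lt) x x∈varsL
    where
    open Enc ρ
    x : ℕ
    x = proj₁ (List.lookup (vl Rt) j)
    x∈varsL : x ∈ map proj₁ (vl Lt)
    x∈varsL = subst (x ∈_) (sym (vars-termG (lhs ρ)))
      (varsSub ρ x (subst (x ∈_) (vars-termG (rhs ρ)) (∈-map⁺ proj₁ (∈-lookup j))))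

module RootMatch (S : Signature) (ρ : TRSDefs.Rule S) (σ : ℕ → TRSDefs.Term S) (lin : TRSDefs.LinearRule S ρ) where
  open Signature S
  open Encoding S
  open FinGraphs Sym
  open Trees S
  open TreeIso S
  open Instantiation S σ
  open VarLists S
  open Enc ρ

  l r : Term
  l = lhs ρ
  r = rhs ρ

  iL : TGIso Lt (tree l)
  iL = termG≅tree l
  iR : TGIso Rt (tree r)
  iR = termG≅tree r

  φL : V GL → VP l
  φL = TGIso.toV iL
  ψL : VP l → V GL
  ψL = TGIso.fromV iL
  φLE : E GL → EP l
  φLE = TGIso.toE iL
  ψLE : EP l → E GL
  ψLE = TGIso.fromE iL
  φR : V GR → VP r
  φR = TGIso.toV iR
  ψR : VP r → V GR
  ψR = TGIso.fromV iR
  φRE : E GR → EP r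
  φRE = TGIso.toE iR
  ψRE : EP r → E GR
  ψRE = TGIso.fromE iR


  nameL : Fin kL → ℕ
  nameL j = proj₁ (List.lookup (vl Lt) j)
  nameR : Fin kR → ℕ
  nameR j = proj₁ (List.lookup (vl Rt) j)

  nameL-inj : ∀ j j' → nameL j ≡ nameL j' → j ≡ j'
  nameL-inj = lookup-injective (vl Lt) (subst Unique (sym (vars-termG l)) (proj₁ lin))
  nameR-inj : ∀ j j' → nameR j ≡ nameR j' → j ≡ j'
  nameR-inj = lookup-injective (vl Rt) (subst Unique (sym (vars-termG r)) (proj₂ lin))

  lo : LocatedRule S ρ
  lo = located ρ

  φj : Fin kR → Fin kL
  φj j = proj₁ (lo j)
  nameφ : ∀ j → nameL (φj j) ≡ nameR j
  nameφ j = find-sound (vl Lt) (nameR j) (φj j) (proj₂ (lo j))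

  memp : ∀ p → (leafVar l p , ψL (leafV l p)) ∈ vl Lt
  memp p = TGIso.vl-fromV iL (vl-leafV⁺ l p)
  idx : Leaf l → Fin kL
  idx p = index (memp p)
  idxSpec : ∀ p → (leafVar l p , ψL (leafV l p)) ≡ List.lookup (vl Lt) (idx p)
  idxSpec p = lookup-index (memp p)
  idxV : ∀ p → vvL (idx p) ≡ ψL (leafV l p)
  idxV p = sym (cong proj₂ (idxSpec p))
  idxN : ∀ p → nameL (idx p) ≡ leafVar l p
  idxN p = sym (cong proj₁ (idxSpec p))

  pLd : ∀ j → Σ (Leaf l) λ p → (φL (vvL j) ≡ leafV l p) × (nameL j ≡ leafVar l p)
  pLd j = vl-leafV⁻ l (TGIso.vl-toV iL (∈-lookup {xs = vl Lt} j))
  pL : Fin kL → Leaf l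
  pL j = proj₁ (pLd j)

  idx-inj : ∀ p p' → idx p ≡ idx p' → p ≡ p'
  idx-inj p p' e = leafV-injective l p p'
    (trans (sym (TGIso.toV-fromV iL _)) (trans (cong φL (trans (sym (idxV p)) (trans (cong vvL e) (idxV p')))) (TGIso.toV-fromV iL _)))
  idx-pL : ∀ j → idx (pL j) ≡ j
  idx-pL j = nameL-inj _ _ (trans (idxN (pL j)) (sym (proj₂ (proj₂ (pLd j)))))
  leafV-pL : ∀ j → leafV l (pL j) ≡ φL (vvL j)
  leafV-pL j = sym (proj₁ (proj₂ (pLd j)))

  memq : ∀ q → (leafVar r q , ψR (leafV r q)) ∈ vl Rt
  memq q = TGIso.vl-fromV iR (vl-leafV⁺ r q)
  idxR : Leaf r → Fin kR
  idxR q = index (memq q)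
  idxRSpec : ∀ q → (leafVar r q , ψR (leafV r q)) ≡ List.lookup (vl Rt) (idxR q)
  idxRSpec q = lookup-index (memq q)
  idxRV : ∀ q → vvR (idxR q) ≡ ψR (leafV r q)
  idxRV q = sym (cong proj₂ (idxRSpec q))
  idxRN : ∀ q → nameR (idxR q) ≡ leafVar r q
  idxRN q = sym (cong proj₁ (idxRSpec q))
  qRd : ∀ j → Σ (Leaf r) λ q → (φR (vvR j) ≡ leafV r q) × (nameR j ≡ leafVar r q)
  qRd j = vl-leafV⁻ r (TGIso.vl-toV iR (∈-lookup {xs = vl Rt} j))
  qR : Fin kR → Leaf r
  qR j = proj₁ (qRd j)
  idxR-inj : ∀ q q' → idxR q ≡ idxR q' → q ≡ q'
  idxR-inj q q' e = leafV-injective r q q'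
    (trans (sym (TGIso.toV-fromV iR _)) (trans (cong φR (trans (sym (idxRV q)) (trans (cong vvR e) (idxRV q')))) (TGIso.toV-fromV iR _)))
  idxR-qR : ∀ j → idxR (qR j) ≡ j
  idxR-qR j = nameR-inj _ _ (trans (idxRN (qR j)) (sym (proj₂ (proj₂ (qRd j)))))
  qR-idxR : ∀ q → qR (idxR q) ≡ q
  qR-idxR q = idxR-inj _ _ (idxR-qR (idxR q))
  leafV-qR : ∀ j → leafV r (qR j) ≡ φR (vvR j)
  leafV-qR j = sym (proj₁ (proj₂ (qRd j)))
  nmqR : ∀ j → leafVar r (qR j) ≡ nameR j
  nmqR j = sym (proj₂ (proj₂ (qRd j)))

  mutual
    lV-leafV : ∀ t p → lV (g (tree t)) (leafV t p) ≡ bot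
    lV-leafV (var x) tt = refl
    lV-leafV (app f ts) p = lV-leafVᵃ f 0 ts p
    lV-leafVᵃ : ∀ f i {n} (ts : Vec Term n) p → lV (g (treeArgs (symbolNode f) i ts)) (leafVᵃ f i ts p) ≡ bot
    lV-leafVᵃ f i (t ∷ ts) (inj₁ p) = lV-leafVᵃ f (suc i) ts p
    lV-leafVᵃ f i (t ∷ ts) (inj₂ p) = lV-leafV t p

  GLσ GRσ : Graph
  GLσ = g (tree (l [ σ ]ₛ))
  GRσ = g (tree (r [ σ ]ₛ))

  xe lp : Fin kL → E L'g
  xe j = inj₂ (inj₁ (inj₁ j))
  lp j = inj₂ (inj₁ (inj₂ j))
  x' : Fin kL → V L'g
  x' j = inj₂ (inj₁ j)

  -- The pattern part goes to l°; in the copy of σ x the root goes to the vertex x and everything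
  -- else to x′, with edges out of the root sent to the edge x → x′ and the others to the loop on x′.
  αV' : VP l ⊎ Region l → V L'g
  αV' (inj₁ y) = inj₁ (ψL y)
  αV' (inj₂ (p , c)) = if isRoot (σ (leafVar l p)) c then inj₁ (ψL (leafV l p)) else x' (idx p)
  αE' : EP l ⊎ RegionE l → E L'g
  αE' (inj₁ y) = inj₁ (ψLE y)
  αE' (inj₂ (p , c)) = if isRoot (σ (leafVar l p)) (src (g (tree (σ (leafVar l p)))) c) then xe (idx p) else lp (idx p)

  αV : V GLσ → V L'g
  αV a = αV' (splitV l a)
  αE : E GLσ → E L'g
  αE e = αE' (splitE l e)

  αmsubAux : ∀ y m → leafAt l y ≡ m → αV' (splitPat l y m) ≡ inj₁ (ψL y)
  αmsubAux y nothing e = refl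
  αmsubAux y (just p) e rewrite isRoot-root (σ (leafVar l p)) = cong (λ z → inj₁ (ψL z)) (sym (leafAt-just l y p e))
  αmsub : ∀ y → αV (patV l y) ≡ inj₁ (ψL y)
  αmsub y = trans (cong αV' (splitV-patV l y)) (αmsubAux y (leafAt l y) refl)

  L'topPos : ∀ p → lV L'g (inj₁ (ψL (leafV l p))) ≡ top
  L'topPos p = markTop-yes (isVarV GL vvL (ψL (leafV l p))) _ (idx p , idxV p)

  srcα' : ∀ x → αV (src GLσ (joinE l x)) ≡ src L'g (αE (joinE l x))
  srcα' (inj₁ y) =
    trans (cong αV (sym (patV-src l y)))
      (trans (αmsub _) (trans (cong inj₁ (fromV-src iL y)) (cong (λ z → src L'g (αE' z)) (sym (splitE-patE l y)))))
  srcα' (inj₂ (p , c)) =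
    trans (cong αV (sym (instV-src l p c)))
      (trans (cong αV' (splitV-instV l p _)) (trans (aux (isRoot (σ (leafVar l p)) (src (g (tree (σ (leafVar l p)))) c))) (cong (λ z → src L'g (αE' z)) (sym (splitE-instE l p c)))))
    where
    aux : ∀ b → (if b then inj₁ (ψL (leafV l p)) else x' (idx p)) ≡ src L'g (if b then xe (idx p) else lp (idx p))
    aux true = cong inj₁ (sym (idxV p))
    aux false = refl

  tgtα' : ∀ x → αV (tgt GLσ (joinE l x)) ≡ tgt L'g (αE (joinE l x))
  tgtα' (inj₁ y) =
    trans (cong αV (sym (patV-tgt l y)))
      (trans (αmsub _) (trans (cong inj₁ (fromV-tgt iL y)) (cong (λ z → tgt L'g (αE' z)) (sym (splitE-patE l y)))))
  tgtα' (inj₂ (p , c)) =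
    trans (cong αV (sym (instV-tgt l p c)))
      (trans (cong αV' (splitV-instV l p _)) (trans (cong (λ b → if b then inj₁ (ψL (leafV l p)) else x' (idx p)) (isRoot-tgt (σ (leafVar l p)) c))
        (trans (aux (isRoot (σ (leafVar l p)) (src (g (tree (σ (leafVar l p)))) c))) (cong (λ z → tgt L'g (αE' z)) (sym (splitE-instE l p c))))))
    where
    aux : ∀ b → x' (idx p) ≡ tgt L'g (if b then xe (idx p) else lp (idx p))
    aux true = refl
    aux false = refl

  lVα' : ∀ x → lV GLσ (joinV l x) ≤L lV L'g (αV (joinV l x))
  lVα' (inj₁ y) with leafAt l y in eq
  ... | nothing = ≤L-respʳ-≡ (≤L-respˡ-≡ (trans (lV-patV l y eq) (sym (lV-fromV iL y))) (markTop-≤ _ _)) (cong (lV L'g) (sym (αmsub y)))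
  ... | just p = ≤L-respʳ-≡ ≤top (sym (trans (cong (lV L'g) (αmsub y)) (trans (cong (λ z → lV L'g (inj₁ (ψL z))) (leafAt-just l y p eq)) (L'topPos p))))
  lVα' (inj₂ (p , c)) = ≤L-respʳ-≡ ≤top (sym (trans (cong (λ z → lV L'g (αV' z)) (splitV-instV l p c)) (aux (isRoot (σ (leafVar l p)) c))))
    where
    aux : ∀ b → lV L'g (if b then inj₁ (ψL (leafV l p)) else x' (idx p)) ≡ top
    aux true = L'topPos p
    aux false = refl

  lEα' : ∀ x → lE GLσ (joinE l x) ≤L lE L'g (αE (joinE l x))
  lEα' (inj₁ y) = ≤L-respˡ-≡ (trans (lE-patE l y) (sym (lE-fromE iL y))) (≤L-respʳ-≡ ≤refl (cong (λ z → lE L'g (αE' z)) (sym (splitE-patE l y))))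
  lEα' (inj₂ (p , c)) = ≤L-respʳ-≡ ≤top (sym (trans (cong (λ z → lE L'g (αE' z)) (splitE-instE l p c)) (aux (isRoot (σ (leafVar l p)) (src (g (tree (σ (leafVar l p)))) c)))))
    where
    aux : ∀ b → lE L'g (if b then xe (idx p) else lp (idx p)) ≡ top
    aux true = refl
    aux false = refl

  αH : Hom GLσ L'g
  αH = record
    { fV = αV ; fE = αE
    ; srcC = λ e → subst (λ e → αV (src GLσ e) ≡ src L'g (αE e)) (joinE-splitE l e) (srcα' (splitE l e))
    ; tgtC = λ e → subst (λ e → αV (tgt GLσ e) ≡ tgt L'g (αE e)) (joinE-splitE l e) (tgtα' (splitE l e))
    ; lV≤ = λ a → subst (λ a → lV GLσ a ≤L lV L'g (αV a)) (joinV-splitV l a) (lVα' (splitV l a))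
    ; lE≤ = λ e → subst (λ e → lE GLσ e ≤L lE L'g (αE e)) (joinE-splitE l e) (lEα' (splitE l e)) }

  mV : V GL → V GLσ
  mV z = patV l (φL z)
  mE : E GL → E GLσ
  mE z = patE l (φLE z)

  mlV : ∀ z → lV GL z ≤L lV GLσ (mV z)
  mlV z with leafAt l (φL z) in eq
  ... | nothing = ≤L-respˡ-≡ (trans (sym (TGIso.lV-toV iL z)) (sym (lV-patV l (φL z) eq))) ≤refl
  ... | just p rewrite sym (TGIso.lV-toV iL z) | leafAt-just l (φL z) p eq | lV-leafV l p = bot≤

  mH : Hom GL GLσ
  mH = record
    { fV = mV ; fE = mE
    ; srcC = λ e → trans (cong (patV l) (TGIso.toV-src iL e)) (patV-src l _)
    ; tgtC = λ e → trans (cong (patV l) (TGIso.toV-tgt iL e)) (patV-tgt l _)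
    ; lV≤ = mlV
    ; lE≤ = λ e → ≤L-respˡ-≡ (trans (sym (TGIso.lE-toE iL e)) (sym (lE-patE l _))) ≤refl }

  αmV : ∀ z → αV (mV z) ≡ inj₁ z
  αmV z = trans (αmsub (φL z)) (cong inj₁ (TGIso.fromV-toV iL z))
  αmE : ∀ z → αE (mE z) ≡ inj₁ z
  αmE z = trans (cong αE' (splitE-patE l (φLE z))) (cong inj₁ (TGIso.fromE-toE iL z))

  reflV' : ∀ x z → αV (joinV l x) ≡ inj₁ z → joinV l x ≡ mV z
  reflV' (inj₁ y) z e = cong (patV l) (trans (sym (TGIso.toV-fromV iL y)) (cong φL (inj₁-injective (trans (sym (αmsub y)) e))))
  reflV' (inj₂ (p , c)) z e with isRoot (σ (leafVar l p)) c in eq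
  ... | true rewrite isRoot⇒≡root (σ (leafVar l p)) c eq =
        trans (instV-root l p) (cong (patV l) (trans (sym (TGIso.toV-fromV iL _)) (cong φL (inj₁-injective (trans (sym (aux (isRoot-root (σ (leafVar l p))))) e)))))
    where
    aux : isRoot (σ (leafVar l p)) (regionRoot l p) ≡ true → αV (instV l p (regionRoot l p)) ≡ inj₁ (ψL (leafV l p))
    aux q = trans (cong αV' (splitV-instV l p _)) (cong (λ b → if b then inj₁ (ψL (leafV l p)) else x' (idx p)) q)
  ... | false = ⊥-elim (inj₁≢inj₂ (sym (trans (sym (trans (cong αV' (splitV-instV l p c)) (cong (λ b → if b then inj₁ (ψL (leafV l p)) else x' (idx p)) eq))) e)))

  reflVH : ∀ a z → αV a ≡ inj₁ z → a ≡ mV z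
  reflVH a z e = trans (sym (joinV-splitV l a)) (reflV' (splitV l a) z (subst (λ a' → αV a' ≡ inj₁ z) (sym (joinV-splitV l a)) e))

  reflEH : ∀ e z → αE e ≡ inj₁ z → e ≡ mE z
  reflEH e z q with splitE l e in eq
  ... | inj₁ y = trans (sym (joinE-splitE l e)) (trans (cong (joinE l) eq)
                   (cong (patE l) (trans (sym (TGIso.toE-fromE iL y)) (cong φLE (inj₁-injective q)))))
  ... | inj₂ (p , c) = ⊥-elim (aux (isRoot (σ (leafVar l p)) (src (g (tree (σ (leafVar l p)))) c)) q)
    where
    aux : ∀ b → (if b then xe (idx p) else lp (idx p)) ≡ inj₁ z → ⊥
    aux true ()
    aux false ()

  castV : ∀ {x y} → x ≡ y → VP (σ x) → VP (σ y)
  castV e c = subst (λ z → VP (σ z)) e c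
  castE : ∀ {x y} → x ≡ y → EP (σ x) → EP (σ y)
  castE e c = subst (λ z → EP (σ z)) e c

  castV-src : ∀ {x y} (e : x ≡ y) c → castV e (src (g (tree (σ x))) c) ≡ src (g (tree (σ y))) (castE e c)
  castV-src refl c = refl
  castV-tgt : ∀ {x y} (e : x ≡ y) c → castV e (tgt (g (tree (σ x))) c) ≡ tgt (g (tree (σ y))) (castE e c)
  castV-tgt refl c = refl
  castV-rt : ∀ {x y} (e : x ≡ y) → castV e (rt (tree (σ x))) ≡ rt (tree (σ y))
  castV-rt refl = refl
  isRoot-cast : ∀ {x y} (e : x ≡ y) c → isRoot (σ y) (castV e c) ≡ isRoot (σ x) c
  isRoot-cast refl c = refl
  lV-cast : ∀ {x y} (e : x ≡ y) c → lV (g (tree (σ y))) (castV e c) ≡ lV (g (tree (σ x))) c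
  lV-cast refl c = refl
  lE-cast : ∀ {x y} (e : x ≡ y) c → lE (g (tree (σ y))) (castE e c) ≡ lE (g (tree (σ x))) c
  lE-cast refl c = refl
  castV-irr : ∀ {x y} (e e' : x ≡ y) c → castV e c ≡ castV e' c
  castV-irr refl refl c = refl
  lVrt-eq : ∀ {x y} → x ≡ y → lV (g (tree (σ x))) (rt (tree (σ x))) ≡ lV (g (tree (σ y))) (rt (tree (σ y)))
  lVrt-eq refl = refl

  instV-castˡ : ∀ p p' → p ≡ p' → ∀ {k} (n : leafVar l p ≡ k) (n' : k ≡ leafVar l p') c → instV l p' (castV n' (castV n c)) ≡ instV l p c
  instV-castˡ p .p refl refl refl c = refl
  instE-castˡ : ∀ p p' → p ≡ p' → ∀ {k} (n : leafVar l p ≡ k) (n' : k ≡ leafVar l p') c → instE l p' (castE n' (castE n c)) ≡ instE l p c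
  instE-castˡ p .p refl refl refl c = refl
  instV-castʳ : ∀ q q' → q ≡ q' → ∀ {k} (n : leafVar r q ≡ k) (n' : k ≡ leafVar r q') c → instV r q' (castV n' (castV n c)) ≡ instV r q c
  instV-castʳ q .q refl refl refl c = refl
  instE-castʳ : ∀ q q' → q ≡ q' → ∀ {k} (n : leafVar r q ≡ k) (n' : k ≡ leafVar r q') c → instE r q' (castE n' (castE n c)) ≡ instE r q c
  instE-castʳ q .q refl refl refl c = refl

  locj : ∀ j → loc j ≡ just (φj j)
  locj j = proj₂ (lo j)

  nEq : ∀ p j → idx p ≡ φj j → leafVar l p ≡ leafVar r (qR j)
  nEq p j e = trans (sym (idxN p)) (trans (cong nameL e) (trans (nameφ j) (sym (nmqR j))))

  x'Vinj₁ : ∀ m y → inj₁ y ≡ x'V m → ⊥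
  x'Vinj₁ (just _) y ()
  x'Vinj₁ nothing y ()

  notCv : ∀ x → αV' x ≡ Cv → ⊥
  notCv (inj₁ y) ()
  notCv (inj₂ (p , c)) q with isRoot (σ (leafVar l p)) c
  notCv (inj₂ (p , c)) () | true
  notCv (inj₂ (p , c)) () | false

  idxFromX' : ∀ p c j → αV' (inj₂ (p , c)) ≡ x'V (loc j) → (idx p ≡ φj j) × (isRoot (σ (leafVar l p)) c ≡ false)
  idxFromX' p c j q with isRoot (σ (leafVar l p)) c | trans q (cong x'V (locj j))
  ... | true | ()
  ... | false | q' = inj₁-injective (inj₂-injective q') , refl

  xeEinj₁ : ∀ m y → inj₁ y ≡ xeE m → ⊥
  xeEinj₁ (just _) y ()
  xeEinj₁ nothing y ()
  loopEinj₁ : ∀ m y → inj₁ y ≡ loopE m → ⊥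
  loopEinj₁ (just _) y ()
  loopEinj₁ nothing y ()

  notCre : ∀ x → αE' x ≡ inj₂ (inj₂ (inj₁ tt)) → ⊥
  notCre (inj₁ y) ()
  notCre (inj₂ (p , c)) q with isRoot (σ (leafVar l p)) (src (g (tree (σ (leafVar l p)))) c)
  notCre (inj₂ (p , c)) () | true
  notCre (inj₂ (p , c)) () | false
  notCCe : ∀ x → αE' x ≡ CCe → ⊥
  notCCe (inj₁ y) ()
  notCCe (inj₂ (p , c)) q with isRoot (σ (leafVar l p)) (src (g (tree (σ (leafVar l p)))) c)
  notCCe (inj₂ (p , c)) () | true
  notCCe (inj₂ (p , c)) () | false

  idxFromXe : ∀ p c j → αE' (inj₂ (p , c)) ≡ xeE (loc j) → (idx p ≡ φj j) × (isRoot (σ (leafVar l p)) (src (g (tree (σ (leafVar l p)))) c) ≡ true)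
  idxFromXe p c j q with isRoot (σ (leafVar l p)) (src (g (tree (σ (leafVar l p)))) c) | trans q (cong xeE (locj j))
  ... | true | q' = inj₁-injective (inj₁-injective (inj₂-injective q')) , refl
  ... | false | ()
  idxFromLp : ∀ p c j → αE' (inj₂ (p , c)) ≡ loopE (loc j) → (idx p ≡ φj j) × (isRoot (σ (leafVar l p)) (src (g (tree (σ (leafVar l p)))) c) ≡ false)
  idxFromLp p c j q with isRoot (σ (leafVar l p)) (src (g (tree (σ (leafVar l p)))) c) | trans q (cong loopE (locj j))
  ... | true | ()
  ... | false | q' = inj₂-injective (inj₁-injective (inj₂-injective q')) , refl

  open StepWitnesses S ρ lo using (K'lV-BotOrTop; K'lE-BotOrTop)
  module PB = Pullback αH l'Hom K'lV-BotOrTop K'lE-BotOrTop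
  GK : Graph
  GK = PB.GK

  wAux : (x : VP l ⊎ Region l) (b : V K'g) → αV' x ≡ l'V b → V GRσ
  wAux x (inj₁ (inj₁ tt)) q = rt (tree (r [ σ ]ₛ))
  wAux x (inj₁ (inj₂ j)) q = patV r (φR (vvR j))
  wAux (inj₁ y) (inj₂ (inj₁ j)) q = ⊥-elim (x'Vinj₁ (loc j) _ q)
  wAux (inj₂ (p , c)) (inj₂ (inj₁ j)) q = instV r (qR j) (castV (nEq p j (proj₁ (idxFromX' p c j q))) c)
  wAux x (inj₂ (inj₂ tt)) q = ⊥-elim (notCv x q)

  wEAux : (x : EP l ⊎ RegionE l) (b : E K'g) → αE' x ≡ l'E b → E GRσ
  wEAux x (inj₁ ()) q
  wEAux (inj₁ y) (inj₂ (inj₁ (inj₁ j))) q = ⊥-elim (xeEinj₁ (loc j) _ q)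
  wEAux (inj₂ (p , c)) (inj₂ (inj₁ (inj₁ j))) q = instE r (qR j) (castE (nEq p j (proj₁ (idxFromXe p c j q))) c)
  wEAux (inj₁ y) (inj₂ (inj₁ (inj₂ j))) q = ⊥-elim (loopEinj₁ (loc j) _ q)
  wEAux (inj₂ (p , c)) (inj₂ (inj₁ (inj₂ j))) q = instE r (qR j) (castE (nEq p j (proj₁ (idxFromLp p c j q))) c)
  wEAux x (inj₂ (inj₂ (inj₁ tt))) q = ⊥-elim (notCre x q)
  wEAux x (inj₂ (inj₂ (inj₂ tt))) q = ⊥-elim (notCCe x q)

  wV : PB.PV → V GRσ
  wV ((a , b) , pf) = wAux (splitV l a) b pf
  wE : PB.PE → E GRσ
  wE ((e , b) , pf) = wEAux (splitE l e) b pf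

  srcPr : EP l ⊎ RegionE l → VP l ⊎ Region l
  srcPr (inj₁ y) = splitPat l (src (g (tree l)) y) (leafAt l (src (g (tree l)) y))
  srcPr (inj₂ (p , c)) = inj₂ (p , src (g (tree (σ (leafVar l p)))) c)
  tgtPr : EP l ⊎ RegionE l → VP l ⊎ Region l
  tgtPr (inj₁ y) = splitPat l (tgt (g (tree l)) y) (leafAt l (tgt (g (tree l)) y))
  tgtPr (inj₂ (p , c)) = inj₂ (p , tgt (g (tree (σ (leafVar l p)))) c)

  splitV-src : ∀ e → splitV l (src GLσ e) ≡ srcPr (splitE l e)
  splitV-src e = trans (cong (λ e' → splitV l (src GLσ e')) (sym (joinE-splitE l e))) (aux (splitE l e))
    where
    aux : ∀ x → splitV l (src GLσ (joinE l x)) ≡ srcPr x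
    aux (inj₁ y) = trans (cong (splitV l) (sym (patV-src l y))) (splitV-patV l _)
    aux (inj₂ (p , c)) = trans (cong (splitV l) (sym (instV-src l p c))) (splitV-instV l p _)
  splitV-tgt : ∀ e → splitV l (tgt GLσ e) ≡ tgtPr (splitE l e)
  splitV-tgt e = trans (cong (λ e' → splitV l (tgt GLσ e')) (sym (joinE-splitE l e))) (aux (splitE l e))
    where
    aux : ∀ x → splitV l (tgt GLσ (joinE l x)) ≡ tgtPr x
    aux (inj₁ y) = trans (cong (splitV l) (sym (patV-tgt l y))) (splitV-patV l _)
    aux (inj₂ (p , c)) = trans (cong (splitV l) (sym (instV-tgt l p c))) (splitV-instV l p _)

  wAux-cong : ∀ {x x'} → x ≡ x' → ∀ b q q' → wAux x b q ≡ wAux x' b q'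
  wAux-cong refl b q q' = cong (wAux _ b) (uip q q')

  patV-var≡instV-root : ∀ j → patV r (φR (vvR j)) ≡ instV r (qR j) (regionRoot r (qR j))
  patV-var≡instV-root j = trans (cong (patV r) (sym (leafV-qR j))) (sym (instV-root r (qR j)))

  wsrcAux : ∀ x b (q : αE' x ≡ l'E b) (q' : αV' (srcPr x) ≡ l'V (src K'g b)) → wAux (srcPr x) (src K'g b) q' ≡ src GRσ (wEAux x b q)
  wsrcAux x (inj₁ ()) q q'
  wsrcAux (inj₁ y) (inj₂ (inj₁ (inj₁ j))) q q' = ⊥-elim (xeEinj₁ (loc j) _ q)
  wsrcAux (inj₂ (p , c)) (inj₂ (inj₁ (inj₁ j))) q q' =
    trans (patV-var≡instV-root j) (trans (cong (instV r (qR j)) (trans (sym (castV-rt n))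
      (trans (cong (castV n) (sym (isRoot⇒≡root (σ (leafVar l p)) _ (proj₂ (idxFromXe p c j q))))) (castV-src n c)))) (instV-src r (qR j) _))
    where
    n : leafVar l p ≡ leafVar r (qR j)
    n = nEq p j (proj₁ (idxFromXe p c j q))
  wsrcAux (inj₁ y) (inj₂ (inj₁ (inj₂ j))) q q' = ⊥-elim (loopEinj₁ (loc j) _ q)
  wsrcAux (inj₂ (p , c)) (inj₂ (inj₁ (inj₂ j))) q q' =
    trans (cong (instV r (qR j)) (trans (castV-irr _ n _) (castV-src n c))) (instV-src r (qR j) _)
    where
    n : leafVar l p ≡ leafVar r (qR j)
    n = nEq p j (proj₁ (idxFromLp p c j q))
  wsrcAux x (inj₂ (inj₂ (inj₁ tt))) q q' = ⊥-elim (notCre x q)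
  wsrcAux x (inj₂ (inj₂ (inj₂ tt))) q q' = ⊥-elim (notCCe x q)

  wtgtAux : ∀ x b (q : αE' x ≡ l'E b) (q' : αV' (tgtPr x) ≡ l'V (tgt K'g b)) → wAux (tgtPr x) (tgt K'g b) q' ≡ tgt GRσ (wEAux x b q)
  wtgtAux x (inj₁ ()) q q'
  wtgtAux (inj₁ y) (inj₂ (inj₁ (inj₁ j))) q q' = ⊥-elim (xeEinj₁ (loc j) _ q)
  wtgtAux (inj₂ (p , c)) (inj₂ (inj₁ (inj₁ j))) q q' =
    trans (cong (instV r (qR j)) (trans (castV-irr _ n _) (castV-tgt n c))) (instV-tgt r (qR j) _)
    where
    n : leafVar l p ≡ leafVar r (qR j)
    n = nEq p j (proj₁ (idxFromXe p c j q))
  wtgtAux (inj₁ y) (inj₂ (inj₁ (inj₂ j))) q q' = ⊥-elim (loopEinj₁ (loc j) _ q)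
  wtgtAux (inj₂ (p , c)) (inj₂ (inj₁ (inj₂ j))) q q' =
    trans (cong (instV r (qR j)) (trans (castV-irr _ n _) (castV-tgt n c))) (instV-tgt r (qR j) _)
    where
    n : leafVar l p ≡ leafVar r (qR j)
    n = nEq p j (proj₁ (idxFromLp p c j q))
  wtgtAux x (inj₂ (inj₂ (inj₁ tt))) q q' = ⊥-elim (notCre x q)
  wtgtAux x (inj₂ (inj₂ (inj₂ tt))) q q' = ⊥-elim (notCCe x q)

  wsrc : ∀ E → wV (PB.psrc E) ≡ src GRσ (wE E)
  wsrc ((e , b) , pf) = trans (wAux-cong (splitV-src e) (src K'g b) _ q') (wsrcAux (splitE l e) b pf q')
    where
    q' : αV' (srcPr (splitE l e)) ≡ l'V (src K'g b)
    q' = trans (cong αV' (sym (splitV-src e))) (proj₂ (PB.psrc ((e , b) , pf)))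
  wtgt : ∀ E → wV (PB.ptgt E) ≡ tgt GRσ (wE E)
  wtgt ((e , b) , pf) = trans (wAux-cong (splitV-tgt e) (tgt K'g b) _ q') (wtgtAux (splitE l e) b pf q')
    where
    q' : αV' (tgtPr (splitE l e)) ≡ l'V (tgt K'g b)
    q' = trans (cong αV' (sym (splitV-tgt e))) (proj₂ (PB.ptgt ((e , b) , pf)))

  lV-patV-leaf : ∀ t p → lV (g (tree (t [ σ ]ₛ))) (patV t (leafV t p)) ≡ lV (g (tree (σ (leafVar t p)))) (rt (tree (σ (leafVar t p))))
  lV-patV-leaf t p = trans (cong (lV (g (tree (t [ σ ]ₛ)))) (sym (instV-root t p))) (lV-instV t p _)

  mVpL : ∀ φ → mV (vvL φ) ≡ patV l (leafV l (pL φ))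
  mVpL φ = cong (patV l) (sym (leafV-pL φ))

  wlx : ∀ x j (q : αV' x ≡ l'V (inj₂ (inj₁ j))) → lV GLσ (joinV l x) ≤L lV GRσ (wAux x (inj₂ (inj₁ j)) q)
  wlx (inj₁ y) j q = ⊥-elim (x'Vinj₁ (loc j) _ q)
  wlx (inj₂ (p , c)) j q = ≤L-respˡ-≡ (trans (lV-instV l p c) (trans (sym (lV-cast n c)) (sym (lV-instV r (qR j) _)))) ≤refl
    where
    n : leafVar l p ≡ leafVar r (qR j)
    n = nEq p j (proj₁ (idxFromX' p c j q))

  wlV : ∀ K → lV GK K ≤L lV GRσ (wV K)
  wlV ((a , inj₁ (inj₁ tt)) , pf) with isVarV Kg inj₂ (inj₁ tt)
  ... | yes (_ , ())
  ... | no _ = bot≤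
  wlV ((a , inj₁ (inj₂ j)) , pf) =
    ≤L-respˡ-≡ (meet-top _ (markTop-yes (isVarV Kg inj₂ (inj₂ j)) bot (j , refl)))
      (≤L-respˡ-≡ (trans (cong (lV GLσ) (trans (reflVH a _ (trans pf (cong xV (locj j)))) (mVpL (φj j))))
              (trans (lV-patV-leaf l (pL (φj j))) (trans (lVrt-eq (nEq (pL (φj j)) j (idx-pL (φj j))))
                (trans (sym (lV-patV-leaf r (qR j))) (cong (λ z → lV GRσ (patV r z)) (leafV-qR j)))))) ≤refl)
  wlV ((a , inj₂ (inj₁ j)) , pf) = ≤L-respˡ-≡ (cong (lV GLσ) (sym (joinV-splitV l a))) (wlx (splitV l a) j pf)
  wlV ((a , inj₂ (inj₂ tt)) , pf) = ⊥-elim (notCv (splitV l a) pf)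

  wlEx : ∀ x b (q : αE' x ≡ l'E (inj₂ (inj₁ b))) → lE GLσ (joinE l x) ≤L lE GRσ (wEAux x (inj₂ (inj₁ b)) q)
  wlEx (inj₁ y) (inj₁ j) q = ⊥-elim (xeEinj₁ (loc j) _ q)
  wlEx (inj₁ y) (inj₂ j) q = ⊥-elim (loopEinj₁ (loc j) _ q)
  wlEx (inj₂ (p , c)) (inj₁ j) q = ≤L-respˡ-≡ (trans (lE-instE l p c) (trans (sym (lE-cast _ c)) (sym (lE-instE r (qR j) _)))) ≤refl
  wlEx (inj₂ (p , c)) (inj₂ j) q = ≤L-respˡ-≡ (trans (lE-instE l p c) (trans (sym (lE-cast _ c)) (sym (lE-instE r (qR j) _)))) ≤refl

  wlE : ∀ K → lE GK K ≤L lE GRσ (wE K)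
  wlE ((e , inj₁ ()) , pf)
  wlE ((e , inj₂ (inj₁ b)) , pf) = ≤L-respˡ-≡ (cong (lE GLσ) (sym (joinE-splitE l e))) (wlEx (splitE l e) b pf)
  wlE ((e , inj₂ (inj₂ (inj₁ tt))) , pf) = ⊥-elim (notCre (splitE l e) pf)
  wlE ((e , inj₂ (inj₂ (inj₂ tt))) , pf) = ⊥-elim (notCCe (splitE l e) pf)

  wH : Hom GK GRσ
  wH = record { fV = wV ; fE = wE ; srcC = wsrc ; tgtC = wtgt ; lV≤ = wlV ; lE≤ = wlE }

  vV : V GR → V GRσ
  vV z = patV r (φR z)
  vE : E GR → E GRσ
  vE z = patE r (φRE z)

  vlV : ∀ z → lV GR z ≤L lV GRσ (vV z)
  vlV z with leafAt r (φR z) in eq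
  ... | nothing = ≤L-respˡ-≡ (trans (sym (TGIso.lV-toV iR z)) (sym (lV-patV r (φR z) eq))) ≤refl
  ... | just p rewrite sym (TGIso.lV-toV iR z) | leafAt-just r (φR z) p eq | lV-leafV r p = bot≤

  vH : Hom GR GRσ
  vH = record
    { fV = vV ; fE = vE
    ; srcC = λ e → trans (cong (patV r) (TGIso.toV-src iR e)) (patV-src r _)
    ; tgtC = λ e → trans (cong (patV r) (TGIso.toV-tgt iR e)) (patV-tgt r _)
    ; lV≤ = vlV
    ; lE≤ = λ e → ≤L-respˡ-≡ (trans (sym (TGIso.lE-toE iR e)) (sym (lE-patE r _))) ≤refl }

  open StepWitnesses S ρ lo using (tL∘l≗l'∘tK; Witness; RootTracked)

  uKH : Hom Kg GK
  uKH = record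
    { fV = λ x → (mV (fV lHom x) , inj₁ x) , trans (αmV _) (tL∘l≗l'∘tK x)
    ; fE = λ () ; srcC = λ () ; tgtC = λ () ; lV≤ = λ _ → bot≤ ; lE≤ = λ () }

  pq : Leaf r → Leaf l
  pq q = pL (φj (idxR q))
  n2 : ∀ q → leafVar r q ≡ leafVar l (pq q)
  n2 q = trans (sym (idxRN q)) (trans (sym (nameφ (idxR q))) (proj₂ (proj₂ (pLd (φj (idxR q))))))
  ψposp : ∀ q → ψL (leafV l (pq q)) ≡ vvL (φj (idxR q))
  ψposp q = trans (cong ψL (leafV-pL _)) (TGIso.fromV-toV iL _)
  lHomj : ∀ j → fV lHom (inj₂ j) ≡ vvL (φj j)
  lHomj j = cong (May.maybe vvL (rt Lt)) (locj j)

  xv x'v : Fin kR → V K'g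
  xv j = inj₁ (inj₂ j)
  x'v j = inj₂ (inj₁ j)
  xe' lp' : Fin kR → E K'g
  xe' j = inj₂ (inj₁ (inj₁ j))
  lp' j = inj₂ (inj₁ (inj₂ j))

  gkAux : ∀ q (c : VP (σ (leafVar r q))) bb → isRoot (σ (leafVar r q)) c ≡ bb → PB.PV
  gkAux q c true eb = (instV l (pq q) (castV (n2 q) c) , xv (idxR q)) ,
    trans (cong αV' (splitV-instV l (pq q) _))
      (trans (cong (λ b → if b then inj₁ (ψL (leafV l (pq q))) else x' (idx (pq q))) (trans (isRoot-cast (n2 q) c) eb))
        (trans (cong inj₁ (ψposp q)) (sym (cong xV (locj (idxR q))))))
  gkAux q c false eb = (instV l (pq q) (castV (n2 q) c) , x'v (idxR q)) ,
    trans (cong αV' (splitV-instV l (pq q) _))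
      (trans (cong (λ b → if b then inj₁ (ψL (leafV l (pq q))) else x' (idx (pq q))) (trans (isRoot-cast (n2 q) c) eb))
        (trans (cong x' (idx-pL _)) (sym (cong x'V (locj (idxR q))))))

  isRoot-src-cast : ∀ {x y} (e : x ≡ y) c → isRoot (σ y) (src (g (tree (σ y))) (castE e c)) ≡ isRoot (σ x) (src (g (tree (σ x))) c)
  isRoot-src-cast refl c = refl

  gkEAux : ∀ q (c : EP (σ (leafVar r q))) bb → isRoot (σ (leafVar r q)) (src (g (tree (σ (leafVar r q)))) c) ≡ bb → PB.PE
  gkEAux q c true eb = (instE l (pq q) (castE (n2 q) c) , xe' (idxR q)) ,
    trans (cong αE' (splitE-instE l (pq q) _))
      (trans (cong (λ b → if b then xe (idx (pq q)) else lp (idx (pq q))) (trans (isRoot-src-cast (n2 q) c) eb))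
        (trans (cong xe (idx-pL _)) (sym (cong xeE (locj (idxR q))))))
  gkEAux q c false eb = (instE l (pq q) (castE (n2 q) c) , lp' (idxR q)) ,
    trans (cong αE' (splitE-instE l (pq q) _))
      (trans (cong (λ b → if b then xe (idx (pq q)) else lp (idx (pq q))) (trans (isRoot-src-cast (n2 q) c) eb))
        (trans (cong lp (idx-pL _)) (sym (cong loopE (locj (idxR q))))))

  gkV : ∀ q → VP (σ (leafVar r q)) → PB.PV
  gkV q c = gkAux q c (isRoot (σ (leafVar r q)) c) refl
  gkE : ∀ q → EP (σ (leafVar r q)) → PB.PE
  gkE q c = gkEAux q c (isRoot (σ (leafVar r q)) (src (g (tree (σ (leafVar r q)))) c)) refl

  fstGK : ∀ q c bb eb → proj₁ (gkAux q c bb eb) ≡ (instV l (pq q) (castV (n2 q) c) , (if bb then xv (idxR q) else x'v (idxR q)))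
  fstGK q c true eb = refl
  fstGK q c false eb = refl
  fstGKE : ∀ q c bb eb → proj₁ (gkEAux q c bb eb) ≡ (instE l (pq q) (castE (n2 q) c) , (if bb then xe' (idxR q) else lp' (idxR q)))
  fstGKE q c true eb = refl
  fstGKE q c false eb = refl

  gkLab : ∀ q c bb eb → lV GK (gkAux q c bb eb) ≡ lV (g (tree (σ (leafVar r q)))) c
  gkLab q c true eb = trans (meet-top _ (markTop-yes (isVarV Kg inj₂ (inj₂ (idxR q))) bot (idxR q , refl)))
                            (trans (lV-instV l (pq q) _) (lV-cast (n2 q) c))
  gkLab q c false eb = trans (lV-instV l (pq q) _) (lV-cast (n2 q) c)
  gkELab : ∀ q c bb eb → lE GK (gkEAux q c bb eb) ≡ lE (g (tree (σ (leafVar r q)))) c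
  gkELab q c true eb = trans (lE-instE l (pq q) _) (lE-cast (n2 q) c)
  gkELab q c false eb = trans (lE-instE l (pq q) _) (lE-cast (n2 q) c)

  wEAux-cong : ∀ {x x'} → x ≡ x' → ∀ b q q' → wEAux x b q ≡ wEAux x' b q'
  wEAux-cong refl b q q' = cong (wEAux _ b) (uip q q')

  instV-regionRoot-cong : ∀ q' q → q' ≡ q → instV r q' (regionRoot r q') ≡ instV r q (regionRoot r q)
  instV-regionRoot-cong q' .q' refl = refl

  wgk : ∀ q c bb eb → wV (gkAux q c bb eb) ≡ instV r q c
  wgk q c true eb = trans (patV-var≡instV-root (idxR q)) (trans (instV-regionRoot-cong _ _ (qR-idxR q)) (cong (instV r q) (sym (isRoot⇒≡root (σ (leafVar r q)) c eb))))
  wgk q c false eb = trans (wAux-cong (splitV-instV l (pq q) (castV (n2 q) c)) (x'v (idxR q)) _ q'')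
                       (instV-castʳ q (qR (idxR q)) (sym (qR-idxR q)) (n2 q) N c)
    where
    q'' : αV' (inj₂ (pq q , castV (n2 q) c)) ≡ l'V (x'v (idxR q))
    q'' = trans (cong αV' (sym (splitV-instV l (pq q) (castV (n2 q) c)))) (proj₂ (gkAux q c false eb))
    N : leafVar l (pq q) ≡ leafVar r (qR (idxR q))
    N = nEq (pq q) (idxR q) (proj₁ (idxFromX' (pq q) (castV (n2 q) c) (idxR q) q''))

  wgkE : ∀ q c bb eb → wE (gkEAux q c bb eb) ≡ instE r q c
  wgkE q c true eb = trans (wEAux-cong (splitE-instE l (pq q) (castE (n2 q) c)) (xe' (idxR q)) _ q'')
                       (instE-castʳ q (qR (idxR q)) (sym (qR-idxR q)) (n2 q) N c)
    where
    q'' : αE' (inj₂ (pq q , castE (n2 q) c)) ≡ l'E (xe' (idxR q))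
    q'' = trans (cong αE' (sym (splitE-instE l (pq q) (castE (n2 q) c)))) (proj₂ (gkEAux q c true eb))
    N : leafVar l (pq q) ≡ leafVar r (qR (idxR q))
    N = nEq (pq q) (idxR q) (proj₁ (idxFromXe (pq q) (castE (n2 q) c) (idxR q) q''))
  wgkE q c false eb = trans (wEAux-cong (splitE-instE l (pq q) (castE (n2 q) c)) (lp' (idxR q)) _ q'')
                       (instE-castʳ q (qR (idxR q)) (sym (qR-idxR q)) (n2 q) N c)
    where
    q'' : αE' (inj₂ (pq q , castE (n2 q) c)) ≡ l'E (lp' (idxR q))
    q'' = trans (cong αE' (sym (splitE-instE l (pq q) (castE (n2 q) c)))) (proj₂ (gkEAux q c false eb))
    N : leafVar l (pq q) ≡ leafVar r (qR (idxR q))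
    N = nEq (pq q) (idxR q) (proj₁ (idxFromLp (pq q) (castE (n2 q) c) (idxR q) q''))

  wK : ∀ x a pf → wV ((a , inj₁ x) , pf) ≡ vV (fV rHom x)
  wK (inj₁ tt) a pf = sym (trans (cong (patV r) (TGIso.toV-rt iR)) (patV-root r))
  wK (inj₂ j) a pf = refl

  αrt : fV αH (rt (tree (l [ σ ]ₛ))) ≡ inj₁ (rt Lt)
  αrt = trans (cong αV (sym (patV-root l))) (trans (αmsub _) (cong inj₁ (trans (cong ψL (sym (TGIso.toV-rt iL))) (TGIso.fromV-toV iL _))))

module RootWitness (S : Signature) (ρ : TRSDefs.Rule S) (σ : ℕ → TRSDefs.Term S) (lin : TRSDefs.LinearRule S ρ) where
  open Signature S
  open Encoding S
  open FinGraphs Sym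
  open Trees S
  open TreeIso S
  open Instantiation S σ
  open VarLists S
  open Enc ρ
  open RootMatch S ρ σ lin
  open StepWitnesses S ρ lo using (tL∘l≗l'∘tK; Witness; RootTracked)

  module Mediating (Q : Graph) (p₁ : Hom GK Q) (q₁ : Hom GR Q) (cV : ∀ x → fV p₁ (fV uKH x) ≡ fV q₁ (fV rHom x)) where
    p1eq : ∀ {k k' : PB.PV} → proj₁ k ≡ proj₁ k' → fV p₁ k ≡ fV p₁ k'
    p1eq e = cong (fV p₁) (PB.PV-≡ e)
    p1eqE : ∀ {k k' : PB.PE} → proj₁ k ≡ proj₁ k' → fE p₁ k ≡ fE p₁ k'
    p1eqE e = cong (fE p₁) (PB.PE-≡ e)

    hAux : VP r ⊎ Region r → V Q
    hAux (inj₁ y) = fV q₁ (ψR y)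
    hAux (inj₂ (q , c)) = fV p₁ (gkV q c)
    hEAux : EP r ⊎ RegionE r → E Q
    hEAux (inj₁ y) = fE q₁ (ψRE y)
    hEAux (inj₂ (q , c)) = fE p₁ (gkE q c)
    hV : V GRσ → V Q
    hV b = hAux (splitV r b)
    hE : E GRσ → E Q
    hE e = hEAux (splitE r e)

    hmsub : ∀ y → hV (patV r y) ≡ fV q₁ (ψR y)
    hmsub y = trans (cong hAux (splitV-patV r y)) (aux (leafAt r y) refl)
      where
      aux : ∀ m → leafAt r y ≡ m → hAux (splitPat r y m) ≡ fV q₁ (ψR y)
      aux nothing e = refl
      aux (just q) e =
        trans (p1eq {gkV q (regionRoot r q)} {fV uKH (inj₂ (idxR q))}
                 (trans (fstGK q _ _ refl) (cong₂ _,_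
                   (trans (cong (instV l (pq q)) (castV-rt (n2 q))) (trans (instV-root l (pq q)) (trans (sym (mVpL _)) (cong mV (sym (lHomj _))))))
                   (cong (λ b → if b then xv (idxR q) else x'v (idxR q)) (isRoot-root (σ (leafVar r q)))))))
          (trans (cV (inj₂ (idxR q))) (cong (fV q₁) (trans (idxRV q) (cong ψR (sym (leafAt-just r y q e))))))

    hvV : ∀ z → hV (vV z) ≡ fV q₁ z
    hvV z = trans (hmsub (φR z)) (cong (fV q₁) (TGIso.fromV-toV iR z))
    hvE : ∀ z → hE (vE z) ≡ fE q₁ z
    hvE z = trans (cong hEAux (splitE-patE r (φRE z))) (cong (fE q₁) (TGIso.fromE-toE iR z))

    psrcGK : ∀ q c bb eb → proj₁ (PB.psrc (gkEAux q c bb eb)) ≡ (src GLσ (instE l (pq q) (castE (n2 q) c)) , (if bb then xv (idxR q) else x'v (idxR q)))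
    psrcGK q c true eb = refl
    psrcGK q c false eb = refl
    ptgtGK : ∀ q c bb eb → proj₁ (PB.ptgt (gkEAux q c bb eb)) ≡ (tgt GLσ (instE l (pq q) (castE (n2 q) c)) , x'v (idxR q))
    ptgtGK q c true eb = refl
    ptgtGK q c false eb = refl

    hsrc' : ∀ x → hV (src GRσ (joinE r x)) ≡ src Q (hE (joinE r x))
    hsrc' (inj₁ y) = trans (cong hV (sym (patV-src r y))) (trans (hmsub _) (trans (cong (fV q₁) (fromV-src iR y))
                       (trans (srcC q₁ _) (cong (λ z → src Q (hEAux z)) (sym (splitE-patE r y))))))
    hsrc' (inj₂ (q , c)) =
      trans (cong hV (sym (instV-src r q c))) (trans (cong hAux (splitV-instV r q _))
        (trans (p1eq {gkV q _} {PB.psrc (gkE q c)} (trans (fstGK q _ _ refl) (sym (trans (psrcGK q c _ refl)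
            (cong₂ _,_ (trans (sym (instV-src l (pq q) _)) (cong (instV l (pq q)) (sym (castV-src (n2 q) c)))) refl)))))
          (trans (srcC p₁ (gkE q c)) (cong (λ z → src Q (hEAux z)) (sym (splitE-instE r q c))))))

    htgt' : ∀ x → hV (tgt GRσ (joinE r x)) ≡ tgt Q (hE (joinE r x))
    htgt' (inj₁ y) = trans (cong hV (sym (patV-tgt r y))) (trans (hmsub _) (trans (cong (fV q₁) (fromV-tgt iR y))
                       (trans (tgtC q₁ _) (cong (λ z → tgt Q (hEAux z)) (sym (splitE-patE r y))))))
    htgt' (inj₂ (q , c)) =
      trans (cong hV (sym (instV-tgt r q c))) (trans (cong hAux (splitV-instV r q _))
        (trans (p1eq {gkV q _} {PB.ptgt (gkE q c)} (trans (fstGK q _ _ refl) (sym (trans (ptgtGK q c _ refl)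
            (cong₂ _,_ (trans (sym (instV-tgt l (pq q) _)) (cong (instV l (pq q)) (sym (castV-tgt (n2 q) c))))
                       (cong (λ b → if b then xv (idxR q) else x'v (idxR q)) (sym (isRoot-tgt (σ (leafVar r q)) c))))))))
          (trans (tgtC p₁ (gkE q c)) (cong (λ z → tgt Q (hEAux z)) (sym (splitE-instE r q c))))))

    prMsub-inj₁ : ∀ y m → splitPat r y m ≡ inj₁ y → m ≡ nothing
    prMsub-inj₁ y nothing e = refl
    prMsub-inj₁ y (just q) ()

    hlx : ∀ x → splitV r (joinV r x) ≡ x → lV GRσ (joinV r x) ≤L lV Q (hV (joinV r x))
    hlx (inj₁ y) e = ≤L-respˡ-≡ (trans (lV-patV r y (prMsub-inj₁ y (leafAt r y) (trans (sym (splitV-patV r y)) e))) (sym (lV-fromV iR y)))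
                       (≤L-respʳ-≡ (lV≤ q₁ (ψR y)) (cong (λ z → lV Q (hAux z)) (sym e)))
    hlx (inj₂ (q , c)) e = ≤L-respˡ-≡ (trans (lV-instV r q c) (sym (gkLab q c _ refl)))
                       (≤L-respʳ-≡ (lV≤ p₁ (gkV q c)) (cong (λ z → lV Q (hAux z)) (sym e)))

    hlV : ∀ b → lV GRσ b ≤L lV Q (hV b)
    hlV b = subst (λ b → lV GRσ b ≤L lV Q (hV b)) (joinV-splitV r b) (hlx (splitV r b) (cong (splitV r) (joinV-splitV r b)))

    hlEx : ∀ x → splitE r (joinE r x) ≡ x → lE GRσ (joinE r x) ≤L lE Q (hE (joinE r x))
    hlEx (inj₁ y) e = ≤L-respˡ-≡ (trans (lE-patE r y) (sym (lE-fromE iR y)))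
                       (≤L-respʳ-≡ (lE≤ q₁ (ψRE y)) (cong (λ z → lE Q (hEAux z)) (sym e)))
    hlEx (inj₂ (q , c)) e = ≤L-respˡ-≡ (trans (lE-instE r q c) (sym (gkELab q c _ refl)))
                       (≤L-respʳ-≡ (lE≤ p₁ (gkE q c)) (cong (λ z → lE Q (hEAux z)) (sym e)))

    hlE : ∀ e → lE GRσ e ≤L lE Q (hE e)
    hlE e = subst (λ e → lE GRσ e ≤L lE Q (hE e)) (joinE-splitE r e) (hlEx (splitE r e) (cong (splitE r) (joinE-splitE r e)))

    h : Hom GRσ Q
    h = record
      { fV = hV ; fE = hE
      ; srcC = λ e → subst (λ e → hV (src GRσ e) ≡ src Q (hE e)) (joinE-splitE r e) (hsrc' (splitE r e))
      ; tgtC = λ e → subst (λ e → hV (tgt GRσ e) ≡ tgt Q (hE e)) (joinE-splitE r e) (htgt' (splitE r e))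
      ; lV≤ = hlV ; lE≤ = hlE }

    eqpL : ∀ p j → idx p ≡ φj j → p ≡ pq (qR j)
    eqpL p j e = trans (sym (idx-inj _ _ (idx-pL (idx p)))) (trans (cong pL e) (cong (λ z → pL (φj z)) (sym (idxR-qR j))))

    hwx : ∀ x j (q : αV' x ≡ l'V (x'v j)) {k : PB.PV} → proj₁ k ≡ (joinV l x , x'v j) → hV (wAux x (x'v j) q) ≡ fV p₁ k
    hwx (inj₁ y) j q ek = ⊥-elim (x'Vinj₁ (loc j) _ q)
    hwx (inj₂ (p , c)) j q {k} ek =
      trans (cong hAux (splitV-instV r (qR j) c₁)) (p1eq {gkV (qR j) c₁} {k} (trans (fstGK (qR j) c₁ _ refl) (trans (cong₂ _,_ E1 E2) (sym ek))))
      where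
      n : leafVar l p ≡ leafVar r (qR j)
      n = nEq p j (proj₁ (idxFromX' p c j q))
      c₁ : VP (σ (leafVar r (qR j)))
      c₁ = castV n c
      E1 : instV l (pq (qR j)) (castV (n2 (qR j)) c₁) ≡ instV l p c
      E1 = instV-castˡ p (pq (qR j)) (eqpL p j (proj₁ (idxFromX' p c j q))) n (n2 (qR j)) c
      E2 : (if isRoot (σ (leafVar r (qR j))) c₁ then xv (idxR (qR j)) else x'v (idxR (qR j))) ≡ x'v j
      E2 = trans (cong (λ b → if b then xv (idxR (qR j)) else x'v (idxR (qR j))) (trans (isRoot-cast n c) (proj₂ (idxFromX' p c j q)))) (cong x'v (idxR-qR j))

    hwV : ∀ K → hV (wV K) ≡ fV p₁ K
    hwV ((a , inj₁ x) , pf) =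
      trans (cong hV (wK x a pf)) (trans (hvV (fV rHom x)) (trans (sym (cV x))
        (p1eq {fV uKH x} {(a , inj₁ x) , pf} (cong₂ _,_ (sym (reflVH a (fV lHom x) (trans pf (sym (tL∘l≗l'∘tK x))))) refl))))
    hwV ((a , inj₂ (inj₁ j)) , pf) = hwx (splitV l a) j pf {(a , inj₂ (inj₁ j)) , pf} (cong₂ _,_ (sym (joinV-splitV l a)) refl)
    hwV ((a , inj₂ (inj₂ tt)) , pf) = ⊥-elim (notCv (splitV l a) pf)

    hwEx : ∀ x bj (q : αE' x ≡ l'E (inj₂ (inj₁ bj))) {k : PB.PE} → proj₁ k ≡ (joinE l x , inj₂ (inj₁ bj)) → hE (wEAux x (inj₂ (inj₁ bj)) q) ≡ fE p₁ k
    hwEx (inj₁ y) (inj₁ j) q ek = ⊥-elim (xeEinj₁ (loc j) _ q)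
    hwEx (inj₁ y) (inj₂ j) q ek = ⊥-elim (loopEinj₁ (loc j) _ q)
    hwEx (inj₂ (p , c)) (inj₁ j) q {k} ek =
      trans (cong hEAux (splitE-instE r (qR j) c₁)) (p1eqE {gkE (qR j) c₁} {k} (trans (fstGKE (qR j) c₁ _ refl) (trans (cong₂ _,_ E1 E2) (sym ek))))
      where
      n : leafVar l p ≡ leafVar r (qR j)
      n = nEq p j (proj₁ (idxFromXe p c j q))
      c₁ : EP (σ (leafVar r (qR j)))
      c₁ = castE n c
      E1 : instE l (pq (qR j)) (castE (n2 (qR j)) c₁) ≡ instE l p c
      E1 = instE-castˡ p (pq (qR j)) (eqpL p j (proj₁ (idxFromXe p c j q))) n (n2 (qR j)) c
      E2 : (if isRoot (σ (leafVar r (qR j))) (src (g (tree (σ (leafVar r (qR j))))) c₁) then xe' (idxR (qR j)) else lp' (idxR (qR j))) ≡ xe' j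
      E2 = trans (cong (λ b → if b then xe' (idxR (qR j)) else lp' (idxR (qR j))) (trans (isRoot-src-cast n c) (proj₂ (idxFromXe p c j q)))) (cong xe' (idxR-qR j))
    hwEx (inj₂ (p , c)) (inj₂ j) q {k} ek =
      trans (cong hEAux (splitE-instE r (qR j) c₁)) (p1eqE {gkE (qR j) c₁} {k} (trans (fstGKE (qR j) c₁ _ refl) (trans (cong₂ _,_ E1 E2) (sym ek))))
      where
      n : leafVar l p ≡ leafVar r (qR j)
      n = nEq p j (proj₁ (idxFromLp p c j q))
      c₁ : EP (σ (leafVar r (qR j)))
      c₁ = castE n c
      E1 : instE l (pq (qR j)) (castE (n2 (qR j)) c₁) ≡ instE l p c
      E1 = instE-castˡ p (pq (qR j)) (eqpL p j (proj₁ (idxFromLp p c j q))) n (n2 (qR j)) c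
      E2 : (if isRoot (σ (leafVar r (qR j))) (src (g (tree (σ (leafVar r (qR j))))) c₁) then xe' (idxR (qR j)) else lp' (idxR (qR j))) ≡ lp' j
      E2 = trans (cong (λ b → if b then xe' (idxR (qR j)) else lp' (idxR (qR j))) (trans (isRoot-src-cast n c) (proj₂ (idxFromLp p c j q)))) (cong lp' (idxR-qR j))

    hwE : ∀ K → hE (wE K) ≡ fE p₁ K
    hwE ((e , inj₁ ()) , pf)
    hwE ((e , inj₂ (inj₁ bj)) , pf) = hwEx (splitE l e) bj pf {(e , inj₂ (inj₁ bj)) , pf} (cong₂ _,_ (sym (joinE-splitE l e)) refl)
    hwE ((e , inj₂ (inj₂ (inj₁ tt))) , pf) = ⊥-elim (notCre (splitE l e) pf)
    hwE ((e , inj₂ (inj₂ (inj₂ tt))) , pf) = ⊥-elim (notCCe (splitE l e) pf)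

    uniq : ∀ (h' : Hom GRσ Q) → h' ∘H wH ≈H p₁ → h' ∘H vH ≈H q₁ → h' ≈H h
    uniq h' (e1V , e1E) (e2V , e2E) = uV , uE
      where
      ux : ∀ x → fV h' (joinV r x) ≡ hV (joinV r x)
      ux (inj₁ y) = trans (cong (λ z → fV h' (patV r z)) (sym (TGIso.toV-fromV iR y))) (trans (e2V (ψR y)) (sym (hmsub y)))
      ux (inj₂ (q , c)) = trans (cong (fV h') (sym (wgk q c _ refl))) (trans (e1V (gkV q c)) (sym (cong hAux (splitV-instV r q c))))
      uV : ∀ b → fV h' b ≡ hV b
      uV b = trans (cong (fV h') (sym (joinV-splitV r b))) (trans (ux (splitV r b)) (cong hV (joinV-splitV r b)))
      uEx : ∀ x → fE h' (joinE r x) ≡ hE (joinE r x)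
      uEx (inj₁ y) = trans (cong (λ z → fE h' (patE r z)) (sym (TGIso.toE-fromE iR y))) (trans (e2E (ψRE y)) (sym (cong hEAux (splitE-patE r y))))
      uEx (inj₂ (q , c)) = trans (cong (fE h') (sym (wgkE q c _ refl))) (trans (e1E (gkE q c)) (sym (cong hEAux (splitE-instE r q c))))
      uE : ∀ e → fE h' e ≡ hE e
      uE e = trans (cong (fE h') (sym (joinE-splitE r e))) (trans (uEx (splitE r e)) (cong hE (joinE-splitE r e)))

  po : IsPushout uKH rHom wH vH
  po = ((λ x → wK x _ _) , (λ ())) , λ Q p₁ q₁ c → Mediating.h Q p₁ q₁ (proj₁ c) , (Mediating.hwV Q p₁ q₁ (proj₁ c) , Mediating.hwE Q p₁ q₁ (proj₁ c)) ,
         (Mediating.hvV Q p₁ q₁ (proj₁ c) , Mediating.hvE Q p₁ q₁ (proj₁ c)) , Mediating.uniq Q p₁ q₁ (proj₁ c)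

  rootWitness : Witness GLσ GRσ
  rootWitness = record
    { m = mH
    ; mInjV = λ x y e → trans (sym (TGIso.fromV-toV iL x)) (trans (inj₁-injective (trans (sym (αmsub (φL x))) (trans (cong αV e) (αmsub (φL y))))) (TGIso.fromV-toV iL y))
    ; mInjE = λ x y e → trans (sym (TGIso.fromE-toE iL x)) (trans (cong ψLE (inj₁-injective (trans (sym (splitE-patE l (φLE x))) (trans (cong (splitE l) e) (splitE-patE l (φLE y)))))) (TGIso.fromE-toE iL y))
    ; α = αH ; αmV = αmV ; αmE = αmE ; reflV = reflVH ; reflE = reflEH
    ; w = wH ; v = vH ; po = po }

  rootTracked : RootTracked rootWitness (rt (tree (l [ σ ]ₛ))) (rt (tree (r [ σ ]ₛ)))
  rootTracked = inj₁ (αrt , refl)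

module Simulation (S : Signature) (R : Encoding.TRS S) (lin : Encoding.LinearTRS S R) where
  open Encoding S
  open Trees S
  open VarLists S using (located)

  TrackedStep : Term → Term → Set₁
  TrackedStep t t' = Σ Rule λ ρ → R ρ ×
    Σ (StepWitnesses.Witness S ρ (located ρ) (g (tree t)) (g (tree t'))) λ rs →
      StepWitnesses.RootTracked S ρ (located ρ) rs (rt (tree t)) (rt (tree t'))

  trackStep : ∀ {t t'} → Step R t t' → TrackedStep t t'
  trackStep (root ρ Rρ σ) = ρ , Rρ , RootWitness.rootWitness S ρ σ (lin ρ Rρ) , RootWitness.rootTracked S ρ σ (lin ρ Rρ)
  trackStep (ctx f ts i st) with trackStep st
  ... | ρ , Rρ , rs , ri with liftIntoArgs ρ (located ρ) (symbolNode f) 0 ts i _ rs ri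
  ... | lifted , c = ρ , Rρ , lifted , inj₂ c

  encodeStep : ∀ {t t'} → Step R t t' → Step° R (g (tree t)) (g (tree t'))
  encodeStep st with trackStep st
  ... | ρ , Rρ , rs , _ = ρ , Rρ , StepWitnesses.Witness⇒PBPOStep S ρ (located ρ) rs

lemma36 : (S : Signature) (R : Encoding.TRS S) →
    Encoding.LinearTRS S R → Encoding.Terminating° S R → Encoding.Terminating S R
lemma36 S R lin T° (s , steps) =
  T° ((λ n → g (tree (s n))) , (λ n → encodeStep (steps n)))
  where open Simulation S R lin
        open Encoding S using (g)
        open Trees S using (tree)
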